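{- The following eight mesh patterns $(12,R)$ are pairwise equidistributed, where $R$ ranges over: $\{(0,2),(1,2),(2,2),(2,1)\}$, $\{(0,2),(0,1),(0,0),(1,0)\}$, $\{(1,2),(2,2),(2,1),(2,0)\}$, $\{(0,1),(0,0),(1,0),(2,0)\}$, $\{(0,2),(1,2),(2,2),(2,0)\}$, $\{(0,2),(2,2),(2,1),(2,0)\}$, $\{(0,2),(0,1),(0,0),(2,0)\}$, $\{(0,2),(0,0),(1,0),(2,0)\}$. Moreover, for each such pattern $p$, $s_{n,n-1}(p)=(n-1)!$ for $n\ge1$, and for $n\ge 2$ and $0\le k\le n-2$, $$s_{n,k}(p)=\frac{n!}{(k+1)(k+2)}.$$
   Context: For $R\subseteq\{0,1,2\}^2$ and $\pi=\pi_1\cdots\pi_n\in S_n$, an occurrence of the mesh pattern $(12,R)$ in $\pi$ is a pair of positions $i_1<i_2$ with $\pi_{i_1}<\pi_{i_2}$ such that, setting $x_0=0,x_1=i_1,x_2=i_2,x_3=n+1$ and $y_0=0,y_1=\pi_{i_1},y_2=\pi_{i_2},y_3=n+1$, for every $(a,b)\in R$ there is no index $k$ with $x_a<k<x_{a+1}$ and $y_b<\pi_k<y_{b+1}$. $s_{n,k}(p)$ is the number of $\pi\in S_n$ with exactly $k$ occurrences of $p$; $p_1,p_2$ are equidistributed if $s_{n,k}(p_1)=s_{n,k}(p_2)$ for all $n,k\ge 0$. -}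

module Defs where

open import Data.Nat using (ℕ; zero; suc; _+_; _*_; _∸_; _<ᵇ_; _≡ᵇ_)
open import Data.Bool using (Bool; true; false; _∧_; _∨_; not; if_then_else_)
open import Data.Fin using (Fin; toℕ) renaming (zero to f0; suc to fs)
open import Data.Vec using (Vec; []; _∷_; lookup)
open import Data.List using (List; []; _∷_; map; concatMap; allFin; filter; length)
open import Data.Bool.ListAction using (all; any)
open import Data.Product using (_×_; _,_)
open import Relation.Nullary.Decidable using (yes; no)
open import Data.Bool using (T?)

allVecs : (m n : ℕ) → List (Vec (Fin n) m)
allVecs zero    n = [] ∷ []
allVecs (suc m) n = concatMap (λ x → map (x ∷_) (allVecs m n)) (allFin n)

-- A permutation of [n] in one-line notation: entry at 1-based position i is
-- toℕ (lookup v (i-1)) + 1.  v is a permutation iff its entries are distinct.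
isPerm : ∀ {n} → Vec (Fin n) n → Bool
isPerm {n} v = all (λ i → all (λ j → (toℕ i ≡ᵇ toℕ j) ∨ not (toℕ (lookup v i) ≡ᵇ toℕ (lookup v j)))
                         (allFin n)) (allFin n)

Sn : (n : ℕ) → List (Vec (Fin n) n)
Sn n = filter (λ v → T? (isPerm v)) (allVecs n n)

Mesh : Set
Mesh = List (Fin 3 × Fin 3)

_<ᵇ_<ᵇ_ : ℕ → ℕ → ℕ → Bool
a <ᵇ b <ᵇ c = (a <ᵇ b) ∧ (b <ᵇ c)

coord : ℕ → ℕ → ℕ → ℕ → ℕ
coord n u w zero = 0
coord n u w (suc zero) = u
coord n u w (suc (suc zero)) = w
coord n u w (suc (suc (suc _))) = suc n

-- value at 1-based position k (positions are Fin n, k = toℕ i + 1)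
val : ∀ {n} → Vec (Fin n) n → Fin n → ℕ
val v i = suc (toℕ (lookup v i))

isOcc : ∀ {n} → Mesh → Vec (Fin n) n → Fin n → Fin n → Bool
isOcc {n} R π i j =
  (suc (toℕ i) <ᵇ suc (toℕ j)) ∧ (val π i <ᵇ val π j) ∧
  all (λ { (a , b) →
      not (any (λ k →
              (coord n x₁ x₂ (toℕ a) <ᵇ suc (toℕ k) <ᵇ coord n x₁ x₂ (suc (toℕ a))) ∧
              (coord n y₁ y₂ (toℕ b) <ᵇ val π k <ᵇ coord n y₁ y₂ (suc (toℕ b))))
            (allFin n)) }) R
  where
  x₁ = suc (toℕ i)
  x₂ = suc (toℕ j)
  y₁ = val π i
  y₂ = val π j

occ : ∀ {n} → Mesh → Vec (Fin n) n → ℕ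
occ {n} R π = length (concatMap (λ i → filter (λ j → T? (isOcc R π i j)) (allFin n)) (allFin n))

s : Mesh → ℕ → ℕ → ℕ
s R n k = length (filter (λ π → T? (occ R π ≡ᵇ k)) (Sn n))

pattern c0 = f0
pattern c1 = fs f0
pattern c2 = fs (fs f0)

meshes : Fin 8 → Mesh
meshes f0 = (c0 , c2) ∷ (c1 , c2) ∷ (c2 , c2) ∷ (c2 , c1) ∷ []
meshes (fs f0) = (c0 , c2) ∷ (c0 , c1) ∷ (c0 , c0) ∷ (c1 , c0) ∷ []
meshes (fs (fs f0)) = (c1 , c2) ∷ (c2 , c2) ∷ (c2 , c1) ∷ (c2 , c0) ∷ []
meshes (fs (fs (fs f0))) = (c0 , c1) ∷ (c0 , c0) ∷ (c1 , c0) ∷ (c2 , c0) ∷ []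
meshes (fs (fs (fs (fs f0)))) = (c0 , c2) ∷ (c1 , c2) ∷ (c2 , c2) ∷ (c2 , c0) ∷ []
meshes (fs (fs (fs (fs (fs f0))))) = (c0 , c2) ∷ (c2 , c2) ∷ (c2 , c1) ∷ (c2 , c0) ∷ []
meshes (fs (fs (fs (fs (fs (fs f0)))))) = (c0 , c2) ∷ (c0 , c1) ∷ (c0 , c0) ∷ (c2 , c0) ∷ []
meshes (fs (fs (fs (fs (fs (fs (fs f0))))))) = (c0 , c2) ∷ (c0 , c0) ∷ (c1 , c0) ∷ (c2 , c0) ∷ []

module Submission where

-- Three symmetries preserve the distribution of (12, R): permuting the cells of R, inversion
-- π ↦ π⁻¹ (which transposes R) and rotation by 180° (reverse-complement, which rotates R).
-- They reduce the eight patterns to R₂ = {(0,2),(0,1),(0,0),(1,0)} and R₇ = {(0,2),(0,1),(0,0),(2,0)},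
-- and reversing all entries of π but the first carries the occurrences of R₇ to those of R₂.
-- As column 0 of R₂ is shaded, an occurrence must start at π₁, so the number of occurrences of R₂
-- is the length r(π) of the run of entries right after π₁ that exceed π₁. Writing π ∈ S(n+2) as a
-- standardised σ ∈ S(n+1) followed by a last value y, r(π) = r(σ) unless the run of σ covers all of
-- σ; then σ₁ = 1, and r grows by one exactly when y > 1. For T(n,k) = #{π ∈ S(n+1) : r(π) = k} this
-- gives T(n+1,k) = (n+2) T(n,k) for k < n, T(n+1,n) = T(n,n) and T(n+1,n+1) = (n+1) T(n,n), whence
-- T(n,n) = T(n+1,n) = n! and T(m,k) (k+1) (k+2) = (m+1)! for k < m.

open import Defs
open import Data.Nat using (ℕ; suc; _+_; _*_; _∸_; _≤_)
open import Data.Nat using (_!)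
open import Data.Fin using (Fin)
open import Data.Product using (_×_)
open import Relation.Binary.PropositionalEquality using (_≡_)

open import Data.Bool using (Bool; true; false; _∧_; _∨_; not; T; T?; if_then_else_)
open import Data.Bool.Properties using (T-∧; T-∨; T-≡; ∧-comm; ∧-zeroʳ; ∧-identityʳ)
open import Data.Bool.ListAction using (and; or; all; any)
open import Data.Empty using (⊥; ⊥-elim)
open import Data.Unit using (tt)
open import Data.Nat using (zero; _<_; _<ᵇ_; _≡ᵇ_; z≤n; s≤s; s≤s⁻¹)
open import Data.Nat.Properties
  using (+-assoc; +-comm; +-identityʳ; +-suc; *-assoc; *-comm; *-identityʳ; *-zeroʳ; *-distribˡ-+;
         ≡ᵇ⇒≡; ≡⇒≡ᵇ; <ᵇ⇒<; <⇒<ᵇ; ≤-refl; <⇒≤; <-irrefl; <-asym; <-cmp; ≤∧≢⇒<; ≮⇒≥;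
         m≤n⇒m≤1+n; m≤n⇒m<n∨m≡n; m≤m+n; m≢1+m+n; suc-injective;
         +-∸-assoc; n∸n≡0; ∸-monoʳ-≤; ∸-monoʳ-<; ∸-cancelʳ-<)
import Data.Nat.Properties as ℕ
open import Algebra.Properties.Semiring.Sum ℕ.+-*-semiring
  using (sum-syntax; sum-cong-≗; sum-permute; sum-replicate-zero; ∑-comm)
open import Data.Nat.Solver using (module +-*-Solver)
open import Data.Fin using (toℕ; fromℕ; inject₁; opposite; punchIn; punchOut) renaming (zero to f0; suc to fs)
open import Data.Fin.Properties
  using (_≟_; any?; toℕ-injective; toℕ<n; 0≢1+n; opposite-prop; opposite-involutive;
         punchIn-injective; punchOut-injective; injective⇒≤)
  renaming (suc-injective to fs-injective)
open import Data.Fin.Permutation using (permutation)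
open import Data.List as List using (List; []; _∷_; _++_; concatMap; filter; length; allFin)
open import Data.List.Properties using (length-++; map-cong; map-∘)
open import Data.List.Membership.Propositional using (lose)
open import Data.List.Membership.Propositional.Properties using (∈-allFin)
import Data.List.Relation.Unary.All as All
open import Data.List.Relation.Unary.All.Properties using (all⁺; all⁻; all-anti-mono)
open import Data.List.Relation.Unary.Any using (satisfied)
import Data.List.Relation.Unary.Any.Properties as Any
open import Data.Product using (_,_; proj₁; proj₂; ∃; swap) renaming (map to ×-map)
open import Data.Sum using (inj₁; inj₂; [_,_])
open import Data.Vec using (Vec; []; _∷_; _∷ʳ_; lookup; tabulate; map; reverse)
open import Data.Vec.Properties
  using (≡-dec; lookup∘tabulate; tabulate∘lookup; tabulate-cong; lookup-map; reverse-∷; reverse-involutive; map-reverse)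
open import Function using (_∘_; id; _⇔_; mk⇔; Equivalence)
open import Function.Definitions using (Injective)
open import Relation.Binary.Definitions using (DecidableEquality; Tri; tri<; tri≈; tri>)
open import Relation.Nullary using (¬_; Dec; yes; no; does)
open import Relation.Nullary.Decidable using (does-⇔)
open import Relation.Binary.PropositionalEquality using (refl; sym; trans; cong; cong₂; subst; _≢_; module ≡-Reasoning)

T-extensional : ∀ {a b} → T a ⇔ T b → a ≡ b
T-extensional e = does-⇔ e (T? _) (T? _)

T-does : ∀ {P : Set} (p? : Dec P) → T (does p?) ⇔ P
T-does (yes p) = mk⇔ (λ _ → p) (λ _ → tt)
T-does (no ¬p) = mk⇔ (λ ()) ¬p

T-∧⁻ : ∀ a {b} → T (a ∧ b) → T a × T b
T-∧⁻ a = Equivalence.to (T-∧ {a})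

T-not : ∀ {b} → ¬ T b → T (not b)
T-not {false} _ = tt
T-not {true} ¬t = ¬t tt

T-not⁻ : ∀ {b} → T (not b) → ¬ T b
T-not⁻ {false} _ ()

¬T⇒≡false : ∀ {b} → ¬ T b → b ≡ false
¬T⇒≡false {false} _ = refl
¬T⇒≡false {true} ¬t = ⊥-elim (¬t tt)

≡ᵇ-refl : ∀ m → (m ≡ᵇ m) ≡ true
≡ᵇ-refl m = Equivalence.to T-≡ (≡⇒≡ᵇ m m refl)

≢⇒≡ᵇ-false : ∀ {m n} → m ≢ n → (m ≡ᵇ n) ≡ false
≢⇒≡ᵇ-false {m} {n} m≢n = ¬T⇒≡false (m≢n ∘ ≡ᵇ⇒≡ m n)

∧-swapˡ : ∀ a b c → a ∧ b ∧ c ≡ b ∧ a ∧ c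
∧-swapˡ true true c = refl
∧-swapˡ true false c = refl
∧-swapˡ false true c = refl
∧-swapˡ false false c = refl

⟦_⟧ : Bool → ℕ
⟦ true ⟧ = 1
⟦ false ⟧ = 0

⟦∧⟧ : ∀ a b → ⟦ a ∧ b ⟧ ≡ ⟦ a ⟧ * ⟦ b ⟧
⟦∧⟧ true b = sym (+-identityʳ ⟦ b ⟧)
⟦∧⟧ false b = refl

module _ {A : Set} where

  all-cong : ∀ {p q : A → Bool} → (∀ x → p x ≡ q x) → ∀ xs → all p xs ≡ all q xs
  all-cong p≗q xs = cong and (map-cong p≗q xs)

  all-map : ∀ {B : Set} (p : B → Bool) (f : A → B) xs → all p (List.map f xs) ≡ all (p ∘ f) xs
  all-map p f xs = cong and (sym (map-∘ xs))

  all-reverse : ∀ (p : A → Bool) xs → all p (List.reverse xs) ≡ all p xs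
  all-reverse p xs = T-extensional (mk⇔ (all-anti-mono {xs = xs} {ys = List.reverse xs} p Any.reverse⁺)
                                        (all-anti-mono {xs = List.reverse xs} {ys = xs} p Any.reverse⁻))

  any-false : ∀ (xs : List A) → any (λ _ → false) xs ≡ false
  any-false [] = refl
  any-false (x ∷ xs) = any-false xs

T-all-allFin : ∀ {n} (p : Fin n → Bool) → T (all p (allFin n)) ⇔ (∀ i → T (p i))
T-all-allFin {n} p = mk⇔ (λ t i → All.lookup (all⁺ p _ t) (∈-allFin i))
                         (λ h → all⁻ p {allFin n} (All.tabulate λ {i} _ → h i))

T-any-allFin : ∀ {n} (p : Fin n → Bool) → T (any p (allFin n)) ⇔ ∃ (T ∘ p)
T-any-allFin {n} p = mk⇔ (satisfied ∘ Any.any⁻ p (allFin n)) (λ { (k , pk) → Any.any⁺ p (lose (∈-allFin k) pk) })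

any-allFin-reindex : ∀ {n} (p : Fin n → Bool) (f : Fin n → Fin n) → (∀ k → ∃ λ k′ → f k′ ≡ k) →
                     any (p ∘ f) (allFin n) ≡ any p (allFin n)
any-allFin-reindex p f f-onto = T-extensional (mk⇔
  (λ t → let (k , pfk) = Equivalence.to (T-any-allFin (p ∘ f)) t in Equivalence.from (T-any-allFin p) (f k , pfk))
  (λ t → let (k , pk) = Equivalence.to (T-any-allFin p) t
             (k′ , fk′≡k) = f-onto k
         in Equivalence.from (T-any-allFin (p ∘ f)) (k′ , subst (T ∘ p) (sym fk′≡k) pk)))

T-toℕ-≡ᵇ : ∀ {n} {i j : Fin n} → T (toℕ i ≡ᵇ toℕ j) ⇔ i ≡ j
T-toℕ-≡ᵇ {i = i} {j} =
  mk⇔ (toℕ-injective ∘ ≡ᵇ⇒≡ (toℕ i) (toℕ j)) (≡⇒≡ᵇ (toℕ i) (toℕ j) ∘ cong toℕ)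

module _ {A : Set} where

  ∑ₗ : List A → (A → ℕ) → ℕ
  ∑ₗ [] f = 0
  ∑ₗ (x ∷ xs) f = f x + ∑ₗ xs f

  syntax ∑ₗ xs (λ x → e) = ∑[ x ∈ xs ] e

  ∑ₗ-cong : ∀ xs {f g : A → ℕ} → (∀ x → f x ≡ g x) → ∑ₗ xs f ≡ ∑ₗ xs g
  ∑ₗ-cong [] e = refl
  ∑ₗ-cong (x ∷ xs) e = cong₂ _+_ (e x) (∑ₗ-cong xs e)

  ∑ₗ-++ : ∀ xs ys (f : A → ℕ) → ∑ₗ (xs ++ ys) f ≡ ∑ₗ xs f + ∑ₗ ys f
  ∑ₗ-++ [] ys f = refl
  ∑ₗ-++ (x ∷ xs) ys f = trans (cong (f x +_) (∑ₗ-++ xs ys f)) (sym (+-assoc (f x) _ _))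

  ∑ₗ-zero : ∀ xs → ∑[ x ∈ xs ] 0 ≡ 0
  ∑ₗ-zero [] = refl
  ∑ₗ-zero (x ∷ xs) = ∑ₗ-zero xs

  ∑ₗ-distrib-+ : ∀ xs (f g : A → ℕ) → ∑[ x ∈ xs ] (f x + g x) ≡ ∑ₗ xs f + ∑ₗ xs g
  ∑ₗ-distrib-+ [] f g = refl
  ∑ₗ-distrib-+ (x ∷ xs) f g = begin
    f x + g x + ∑[ y ∈ xs ] (f y + g y) ≡⟨ cong (f x + g x +_) (∑ₗ-distrib-+ xs f g) ⟩
    f x + g x + (∑ₗ xs f + ∑ₗ xs g)     ≡⟨ +-assoc (f x) (g x) _ ⟩
    f x + (g x + (∑ₗ xs f + ∑ₗ xs g))   ≡⟨ cong (f x +_) (sym (+-assoc (g x) _ _)) ⟩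
    f x + ((g x + ∑ₗ xs f) + ∑ₗ xs g)   ≡⟨ cong (λ z → f x + (z + ∑ₗ xs g)) (+-comm (g x) _) ⟩
    f x + ((∑ₗ xs f + g x) + ∑ₗ xs g)   ≡⟨ cong (f x +_) (+-assoc (∑ₗ xs f) _ _) ⟩
    f x + (∑ₗ xs f + (g x + ∑ₗ xs g))   ≡⟨ sym (+-assoc (f x) _ _) ⟩
    f x + ∑ₗ xs f + (g x + ∑ₗ xs g)     ∎
    where open ≡-Reasoning

  *-distribˡ-∑ₗ : ∀ c xs (f : A → ℕ) → c * ∑ₗ xs f ≡ ∑[ x ∈ xs ] (c * f x)
  *-distribˡ-∑ₗ c [] f = *-zeroʳ c
  *-distribˡ-∑ₗ c (x ∷ xs) f = trans (*-distribˡ-+ c (f x) _) (cong (c * f x +_) (*-distribˡ-∑ₗ c xs f))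

  length-filter : ∀ (p : A → Bool) xs → length (filter (T? ∘ p) xs) ≡ ∑[ x ∈ xs ] ⟦ p x ⟧
  length-filter p [] = refl
  length-filter p (x ∷ xs) with p x
  ... | true = cong suc (length-filter p xs)
  ... | false = length-filter p xs

  ∑ₗ-filter : ∀ (p : A → Bool) xs (h : A → ℕ) → ∑ₗ (filter (T? ∘ p) xs) h ≡ ∑[ x ∈ xs ] (⟦ p x ⟧ * h x)
  ∑ₗ-filter p [] h = refl
  ∑ₗ-filter p (x ∷ xs) h with p x
  ... | true = cong₂ _+_ (sym (+-identityʳ (h x))) (∑ₗ-filter p xs h)
  ... | false = ∑ₗ-filter p xs h

  ∑ₗ-filter-cong : ∀ (p : A → Bool) xs {f g : A → ℕ} → (∀ x → T (p x) → f x ≡ g x) →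
                   ∑ₗ (filter (T? ∘ p) xs) f ≡ ∑ₗ (filter (T? ∘ p) xs) g
  ∑ₗ-filter-cong p [] e = refl
  ∑ₗ-filter-cong p (x ∷ xs) e with p x in px
  ... | true = cong₂ _+_ (e x (subst T (sym px) tt)) (∑ₗ-filter-cong p xs e)
  ... | false = ∑ₗ-filter-cong p xs e

module _ {A B : Set} where

  ∑ₗ-map : ∀ (g : A → B) xs (f : B → ℕ) → ∑ₗ (List.map g xs) f ≡ ∑ₗ xs (f ∘ g)
  ∑ₗ-map g [] f = refl
  ∑ₗ-map g (x ∷ xs) f = cong (f (g x) +_) (∑ₗ-map g xs f)

  ∑ₗ-concatMap : ∀ (g : A → List B) xs (f : B → ℕ) → ∑ₗ (concatMap g xs) f ≡ ∑[ x ∈ xs ] ∑ₗ (g x) f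
  ∑ₗ-concatMap g [] f = refl
  ∑ₗ-concatMap g (x ∷ xs) f = trans (∑ₗ-++ (g x) _ f) (cong (∑ₗ (g x) f +_) (∑ₗ-concatMap g xs f))

  length-concatMap : ∀ (g : A → List B) xs → length (concatMap g xs) ≡ ∑[ x ∈ xs ] length (g x)
  length-concatMap g [] = refl
  length-concatMap g (x ∷ xs) = trans (length-++ (g x)) (cong (length (g x) +_) (length-concatMap g xs))

  ∑ₗ-comm : ∀ xs ys (h : A → B → ℕ) → ∑[ x ∈ xs ] ∑[ y ∈ ys ] h x y ≡ ∑[ y ∈ ys ] ∑[ x ∈ xs ] h x y
  ∑ₗ-comm [] ys h = sym (∑ₗ-zero ys)
  ∑ₗ-comm (x ∷ xs) ys h = trans (cong (∑ₗ ys (h x) +_) (∑ₗ-comm xs ys h)) (sym (∑ₗ-distrib-+ ys (h x) _))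

∑ₗ-tabulate : ∀ {A : Set} n (g : Fin n → A) (f : A → ℕ) → ∑ₗ (List.tabulate g) f ≡ ∑[ i < n ] f (g i)
∑ₗ-tabulate zero g f = refl
∑ₗ-tabulate (suc n) g f = cong (f (g f0) +_) (∑ₗ-tabulate n (g ∘ fs) f)

∑ₗ-allFin : ∀ n (f : Fin n → ℕ) → ∑ₗ (allFin n) f ≡ ∑[ i < n ] f i
∑ₗ-allFin n = ∑ₗ-tabulate n id

∑-const : ∀ n c → ∑[ i < n ] c ≡ n * c
∑-const zero c = refl
∑-const (suc n) c = cong (c +_) (∑-const n c)

∑-reindex : ∀ {n} (f g : Fin n → Fin n) → (∀ i → f (g i) ≡ i) → (∀ i → g (f i) ≡ i) →
            (h : Fin n → ℕ) → ∑[ i < n ] h (f i) ≡ ∑[ i < n ] h i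
∑-reindex f g fg gf h = sym (sum-permute h (permutation f g fg gf))

module Enumeration {A : Set} (_≟ₐ_ : DecidableEquality A) (L : List A)
                   (once : ∀ a → ∑[ b ∈ L ] ⟦ does (b ≟ₐ a) ⟧ ≡ 1) where

  ∑ₗ-select : ∀ a (h : A → ℕ) → ∑[ b ∈ L ] (⟦ does (b ≟ₐ a) ⟧ * h b) ≡ h a
  ∑ₗ-select a h = begin
    ∑[ b ∈ L ] (⟦ does (b ≟ₐ a) ⟧ * h b) ≡⟨ ∑ₗ-cong L at-a ⟩
    ∑[ b ∈ L ] (h a * ⟦ does (b ≟ₐ a) ⟧) ≡⟨ sym (*-distribˡ-∑ₗ (h a) L _) ⟩
    h a * ∑[ b ∈ L ] ⟦ does (b ≟ₐ a) ⟧   ≡⟨ cong (h a *_) (once a) ⟩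
    h a * 1                              ≡⟨ *-identityʳ (h a) ⟩
    h a                                  ∎
    where
    open ≡-Reasoning
    at-a : ∀ b → ⟦ does (b ≟ₐ a) ⟧ * h b ≡ h a * ⟦ does (b ≟ₐ a) ⟧
    at-a b with b ≟ₐ a
    ... | yes refl = *-comm 1 (h b)
    ... | no _ = sym (*-zeroʳ (h a))

  ∑ₗ-involution : (Q : A → Bool) (f : A → A) →
                  (∀ a → T (Q a) → T (Q (f a))) → (∀ a → T (Q a) → f (f a) ≡ a) →
                  ∀ h → ∑[ a ∈ L ] (⟦ Q a ⟧ * h (f a)) ≡ ∑[ a ∈ L ] (⟦ Q a ⟧ * h a)
  ∑ₗ-involution Q f Q-f ff h = begin
    ∑[ a ∈ L ] (⟦ Q a ⟧ * h (f a))
      ≡⟨ ∑ₗ-cong L (λ a → cong (⟦ Q a ⟧ *_) (sym (∑ₗ-select (f a) h))) ⟩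
    ∑[ a ∈ L ] (⟦ Q a ⟧ * ∑[ b ∈ L ] (⟦ does (b ≟ₐ f a) ⟧ * h b))
      ≡⟨ ∑ₗ-cong L (λ a → *-distribˡ-∑ₗ ⟦ Q a ⟧ L _) ⟩
    ∑[ a ∈ L ] ∑[ b ∈ L ] (⟦ Q a ⟧ * (⟦ does (b ≟ₐ f a) ⟧ * h b))
      ≡⟨ ∑ₗ-comm L L _ ⟩
    ∑[ b ∈ L ] ∑[ a ∈ L ] (⟦ Q a ⟧ * (⟦ does (b ≟ₐ f a) ⟧ * h b))
      ≡⟨ ∑ₗ-cong L (λ b → ∑ₗ-cong L (λ a → graph-swap a b)) ⟩
    ∑[ b ∈ L ] ∑[ a ∈ L ] (⟦ does (a ≟ₐ f b) ⟧ * (⟦ Q b ⟧ * h b))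
      ≡⟨ ∑ₗ-cong L (λ b → ∑ₗ-select (f b) (λ _ → ⟦ Q b ⟧ * h b)) ⟩
    ∑[ b ∈ L ] (⟦ Q b ⟧ * h b) ∎
    where
    open ≡-Reasoning
    graph : ∀ a b → T (Q a ∧ does (b ≟ₐ f a)) → T (does (a ≟ₐ f b) ∧ Q b)
    graph a b t = Equivalence.from T-∧
      (Equivalence.from (T-does (a ≟ₐ f b)) (sym (trans (cong f b≡fa) (ff a qa))) , subst (T ∘ Q) (sym b≡fa) (Q-f a qa))
      where
      qa : T (Q a)
      qa = proj₁ (T-∧⁻ (Q a) t)
      b≡fa : b ≡ f a
      b≡fa = Equivalence.to (T-does (b ≟ₐ f a)) (proj₂ (T-∧⁻ (Q a) t))
    graph⁻ : ∀ a b → T (does (a ≟ₐ f b) ∧ Q b) → T (Q a ∧ does (b ≟ₐ f a))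
    graph⁻ a b t = Equivalence.from T-∧
      (subst (T ∘ Q) (sym a≡fb) (Q-f b qb) , Equivalence.from (T-does (b ≟ₐ f a)) (sym (trans (cong f a≡fb) (ff b qb))))
      where
      qb : T (Q b)
      qb = proj₂ (T-∧⁻ (does (a ≟ₐ f b)) t)
      a≡fb : a ≡ f b
      a≡fb = Equivalence.to (T-does (a ≟ₐ f b)) (proj₁ (T-∧⁻ (does (a ≟ₐ f b)) t))
    graph-swap : ∀ a b → ⟦ Q a ⟧ * (⟦ does (b ≟ₐ f a) ⟧ * h b) ≡ ⟦ does (a ≟ₐ f b) ⟧ * (⟦ Q b ⟧ * h b)
    graph-swap a b = begin
      ⟦ Q a ⟧ * (⟦ does (b ≟ₐ f a) ⟧ * h b) ≡⟨ sym (*-assoc ⟦ Q a ⟧ _ (h b)) ⟩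
      ⟦ Q a ⟧ * ⟦ does (b ≟ₐ f a) ⟧ * h b   ≡⟨ cong (_* h b) (sym (⟦∧⟧ (Q a) _)) ⟩
      ⟦ Q a ∧ does (b ≟ₐ f a) ⟧ * h b
        ≡⟨ cong (λ z → ⟦ z ⟧ * h b) (T-extensional (mk⇔ (graph a b) (graph⁻ a b))) ⟩
      ⟦ does (a ≟ₐ f b) ∧ Q b ⟧ * h b       ≡⟨ cong (_* h b) (⟦∧⟧ (does (a ≟ₐ f b)) _) ⟩
      ⟦ does (a ≟ₐ f b) ⟧ * ⟦ Q b ⟧ * h b   ≡⟨ *-assoc ⟦ does (a ≟ₐ f b) ⟧ _ (h b) ⟩
      ⟦ does (a ≟ₐ f b) ⟧ * (⟦ Q b ⟧ * h b) ∎

-- Permutations as injective vectors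

isInjective : ∀ {m n} → Vec (Fin n) m → Bool
isInjective {m} v = all (λ i → all (λ j → (toℕ i ≡ᵇ toℕ j) ∨ not (toℕ (lookup v i) ≡ᵇ toℕ (lookup v j)))
                              (allFin m)) (allFin m)

T-isInjective : ∀ {m n} (v : Vec (Fin n) m) → T (isInjective v) ⇔ Injective _≡_ _≡_ (lookup v)
T-isInjective {m} v = mk⇔
  (λ t {i} {j} → pair⇒ i j (Equivalence.to (T-all-allFin _) (Equivalence.to (T-all-allFin _) t i) j))
  (λ inj → Equivalence.from (T-all-allFin _) λ i → Equivalence.from (T-all-allFin _) λ j → pair⇐ i j inj)
  where
  distinct : Fin m → Fin m → Bool
  distinct i j = (toℕ i ≡ᵇ toℕ j) ∨ not (toℕ (lookup v i) ≡ᵇ toℕ (lookup v j))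
  pair⇒ : ∀ i j → T (distinct i j) → lookup v i ≡ lookup v j → i ≡ j
  pair⇒ i j t vi≡vj with Equivalence.to T-∨ t
  ... | inj₁ i≡j = Equivalence.to T-toℕ-≡ᵇ i≡j
  ... | inj₂ vi≢vj = ⊥-elim (T-not⁻ vi≢vj (Equivalence.from T-toℕ-≡ᵇ vi≡vj))
  pair⇐ : ∀ i j → Injective _≡_ _≡_ (lookup v) → T (distinct i j)
  pair⇐ i j inj with i ≟ j
  ... | yes i≡j = Equivalence.from T-∨ (inj₁ (Equivalence.from T-toℕ-≡ᵇ i≡j))
  ... | no i≢j = Equivalence.from T-∨ (inj₂ (T-not (i≢j ∘ inj ∘ Equivalence.to T-toℕ-≡ᵇ)))

_∉ᵇ_ : ∀ {m n} → Fin n → Vec (Fin n) m → Bool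
x ∉ᵇ [] = true
x ∉ᵇ (y ∷ w) = not (does (x ≟ y)) ∧ (x ∉ᵇ w)

T-∉ᵇ : ∀ {m n} (x : Fin n) (w : Vec (Fin n) m) → T (x ∉ᵇ w) ⇔ (∀ i → lookup w i ≢ x)
T-∉ᵇ x [] = mk⇔ (λ _ ()) (λ _ → tt)
T-∉ᵇ x (y ∷ w) = mk⇔
  (λ t → let (y≢x , x∉w) = Equivalence.to T-∧ t in
         λ { f0 y≡x → T-not⁻ y≢x (Equivalence.from (T-does (x ≟ y)) (sym y≡x))
           ; (fs i) → Equivalence.to (T-∉ᵇ x w) x∉w i })
  (λ h → Equivalence.from T-∧
     (T-not (h f0 ∘ sym ∘ Equivalence.to (T-does (x ≟ y))) , Equivalence.from (T-∉ᵇ x w) (h ∘ fs)))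

Injective-∷ : ∀ {m n} (x : Fin n) (w : Vec (Fin n) m) →
              Injective _≡_ _≡_ (lookup (x ∷ w)) ⇔ ((∀ i → lookup w i ≢ x) × Injective _≡_ _≡_ (lookup w))
Injective-∷ x w = mk⇔
  (λ inj → (λ i wi≡x → 0≢1+n (inj (sym wi≡x))) , λ {i} {j} e → fs-injective (inj e))
  (λ { (x∉w , inj) {f0} {f0} _ → refl
     ; (x∉w , inj) {f0} {fs j} x≡wj → ⊥-elim (x∉w j (sym x≡wj))
     ; (x∉w , inj) {fs i} {f0} wi≡x → ⊥-elim (x∉w i wi≡x)
     ; (x∉w , inj) {fs i} {fs j} e → cong fs (inj e) })

isInjective-∷ : ∀ {m n} (x : Fin n) (w : Vec (Fin n) m) → isInjective (x ∷ w) ≡ (x ∉ᵇ w) ∧ isInjective w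
isInjective-∷ x w = T-extensional (mk⇔
  (λ t → let (x∉w , inj) = Equivalence.to (Injective-∷ x w) (Equivalence.to (T-isInjective (x ∷ w)) t) in
         Equivalence.from T-∧ (Equivalence.from (T-∉ᵇ x w) x∉w , Equivalence.from (T-isInjective w) inj))
  (λ t → let (x∉w , inj) = Equivalence.to T-∧ t in
         Equivalence.from (T-isInjective (x ∷ w)) (Equivalence.from (Injective-∷ x w)
           (Equivalence.to (T-∉ᵇ x w) x∉w , Equivalence.to (T-isInjective w) inj))))

isInjective-map : ∀ {m n k} {f : Fin n → Fin k} → Injective _≡_ _≡_ f →
                  (w : Vec (Fin n) m) → isInjective (map f w) ≡ isInjective w
isInjective-map {f = f} f-inj w = T-extensional (mk⇔
  (λ t → Equivalence.from (T-isInjective w) λ {i} {j} e →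
     Equivalence.to (T-isInjective (map f w)) t (trans (lookup-map i f w) (trans (cong f e) (sym (lookup-map j f w)))))
  (λ t → Equivalence.from (T-isInjective (map f w)) λ {i} {j} e →
     Equivalence.to (T-isInjective w) t (f-inj (trans (sym (lookup-map i f w)) (trans e (lookup-map j f w))))))

lookup-extensional : ∀ {A : Set} {n} {u w : Vec A n} → (∀ i → lookup u i ≡ lookup w i) → u ≡ w
lookup-extensional {u = u} {w} e = trans (sym (tabulate∘lookup u)) (trans (tabulate-cong e) (tabulate∘lookup w))

module _ {A : Set} where

  lookup-∷ʳ-fromℕ : ∀ {n} (xs : Vec A n) x → lookup (xs ∷ʳ x) (fromℕ n) ≡ x
  lookup-∷ʳ-fromℕ [] x = refl
  lookup-∷ʳ-fromℕ (y ∷ xs) x = lookup-∷ʳ-fromℕ xs x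

  lookup-∷ʳ-inject₁ : ∀ {n} (xs : Vec A n) x i → lookup (xs ∷ʳ x) (inject₁ i) ≡ lookup xs i
  lookup-∷ʳ-inject₁ (y ∷ xs) x f0 = refl
  lookup-∷ʳ-inject₁ (y ∷ xs) x (fs i) = lookup-∷ʳ-inject₁ xs x i

  lookup-reverse-opposite : ∀ {n} (xs : Vec A n) i → lookup (reverse xs) (opposite i) ≡ lookup xs i
  lookup-reverse-opposite (x ∷ xs) i rewrite reverse-∷ x xs with i
  ... | f0 = lookup-∷ʳ-fromℕ (reverse xs) x
  ... | fs j = trans (lookup-∷ʳ-inject₁ (reverse xs) x (opposite j)) (lookup-reverse-opposite xs j)

  lookup-reverse : ∀ {n} (xs : Vec A n) i → lookup (reverse xs) i ≡ lookup xs (opposite i)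
  lookup-reverse xs i = trans (cong (lookup (reverse xs)) (sym (opposite-involutive i)))
                              (lookup-reverse-opposite xs (opposite i))

opposite-injective : ∀ {n} → Injective _≡_ _≡_ (opposite {n})
opposite-injective {x = i} {j} e = trans (sym (opposite-involutive i)) (trans (cong opposite e) (opposite-involutive j))

opposite-antitone : ∀ {n} {j k : Fin n} → toℕ j ≤ toℕ k → toℕ (opposite k) ≤ toℕ (opposite j)
opposite-antitone {n} {j} {k} j≤k rewrite opposite-prop j | opposite-prop k = ∸-monoʳ-≤ n (s≤s j≤k)

isPerm-reindex : ∀ {n} {g h : Fin n → Fin n} → Injective _≡_ _≡_ g → Injective _≡_ _≡_ h →
                 {v w : Vec (Fin n) n} → (∀ i → lookup w i ≡ g (lookup v (h i))) →
                 T (isPerm v) → T (isPerm w)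
isPerm-reindex g-inj h-inj {v} {w} w≡gvh t = Equivalence.from (T-isInjective w) λ {i} {j} e →
  h-inj (Equivalence.to (T-isInjective v) t (g-inj (trans (sym (w≡gvh i)) (trans e (w≡gvh j)))))

injective⇒surjective : ∀ {n} (v : Vec (Fin n) n) → Injective _≡_ _≡_ (lookup v) → ∀ c → ∃ λ k → lookup v k ≡ c
injective⇒surjective v inj c with any? (λ k → lookup v k ≟ c)
... | yes hit = hit
injective⇒surjective {suc n} v inj c | no miss = ⊥-elim (<-irrefl refl (injective⇒≤ punched-inj))
  where
  avoids : ∀ k → c ≢ lookup v k
  avoids k e = miss (k , sym e)
  punched-inj : Injective _≡_ _≡_ (λ k → punchOut (avoids k))
  punched-inj e = inj (punchOut-injective (avoids _) (avoids _) e)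

preimage : ∀ {n} → Vec (Fin n) n → Fin n → Fin n
preimage v c with any? (λ k → lookup v k ≟ c)
... | yes (k , _) = k
... | no _ = c

inverse : ∀ {n} → Vec (Fin n) n → Vec (Fin n) n
inverse v = tabulate (preimage v)

module _ {n} (v : Vec (Fin n) n) (perm : T (isPerm v)) where

  private
    inj : Injective _≡_ _≡_ (lookup v)
    inj = Equivalence.to (T-isInjective v) perm

  lookup-preimage : ∀ c → lookup v (preimage v c) ≡ c
  lookup-preimage c with any? (λ k → lookup v k ≟ c)
  ... | yes (k , vk≡c) = vk≡c
  ... | no miss = ⊥-elim (miss (injective⇒surjective v inj c))

  inverseʳ : ∀ c → lookup v (lookup (inverse v) c) ≡ c
  inverseʳ c = trans (cong (lookup v) (lookup∘tabulate (preimage v) c)) (lookup-preimage c)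

  inverseˡ : ∀ k → lookup (inverse v) (lookup v k) ≡ k
  inverseˡ k = inj (inverseʳ (lookup v k))

  isPerm-inverse : T (isPerm (inverse v))
  isPerm-inverse = Equivalence.from (T-isInjective (inverse v)) λ {i} {j} e →
    trans (sym (inverseʳ i)) (trans (cong (lookup v) e) (inverseʳ j))

inverse-involutive : ∀ {n} (v : Vec (Fin n) n) → T (isPerm v) → inverse (inverse v) ≡ v
inverse-involutive v perm = lookup-extensional λ c →
  Equivalence.to (T-isInjective (inverse v)) (isPerm-inverse v perm)
    (trans (inverseʳ (inverse v) (isPerm-inverse v perm) c) (sym (inverseˡ v perm c)))

isPerm-reverse : ∀ {n} (π : Vec (Fin n) n) → T (isPerm π) → T (isPerm (reverse π))
isPerm-reverse π = isPerm-reindex {g = id} id opposite-injective {π} {reverse π} (lookup-reverse π)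

rotate : ∀ {n} → Vec (Fin n) n → Vec (Fin n) n
rotate π = map opposite (reverse π)

lookup-rotate : ∀ {n} (π : Vec (Fin n) n) k → lookup (rotate π) k ≡ opposite (lookup π (opposite k))
lookup-rotate π k = trans (lookup-map k opposite (reverse π)) (cong opposite (lookup-reverse π k))

rotate-involutive : ∀ {n} (π : Vec (Fin n) n) → rotate (rotate π) ≡ π
rotate-involutive π = lookup-extensional λ k → begin
  lookup (rotate (rotate π)) k                           ≡⟨ lookup-rotate (rotate π) k ⟩
  opposite (lookup (rotate π) (opposite k))              ≡⟨ cong opposite (lookup-rotate π (opposite k)) ⟩
  opposite (opposite (lookup π (opposite (opposite k)))) ≡⟨ opposite-involutive _ ⟩
  lookup π (opposite (opposite k))                       ≡⟨ cong (lookup π) (opposite-involutive k) ⟩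
  lookup π k                                             ∎
  where open ≡-Reasoning

isPerm-rotate : ∀ {n} (π : Vec (Fin n) n) → T (isPerm π) → T (isPerm (rotate π))
isPerm-rotate π = isPerm-reindex opposite-injective opposite-injective {π} {rotate π} (lookup-rotate π)

reverseTail : ∀ {A : Set} {n} → Vec A n → Vec A n
reverseTail [] = []
reverseTail (x ∷ τ) = x ∷ reverse τ

reverseTail-involutive : ∀ {A : Set} {n} (π : Vec A n) → reverseTail (reverseTail π) ≡ π
reverseTail-involutive [] = refl
reverseTail-involutive (x ∷ τ) = cong (x ∷_) (reverse-involutive τ)

isPerm-reverseTail : ∀ {n} (π : Vec (Fin n) n) → T (isPerm π) → T (isPerm (reverseTail π))
isPerm-reverseTail [] _ = tt
isPerm-reverseTail (x ∷ τ) =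
  isPerm-reindex {g = id} id oppositeTail-injective {x ∷ τ} {x ∷ reverse τ} lookup-oppositeTail
  where
  oppositeTail : ∀ {m} → Fin (suc m) → Fin (suc m)
  oppositeTail f0 = f0
  oppositeTail (fs k) = fs (opposite k)
  oppositeTail-injective : ∀ {m} → Injective _≡_ _≡_ (oppositeTail {m})
  oppositeTail-injective {x = f0} {f0} _ = refl
  oppositeTail-injective {x = fs i} {fs j} e = cong fs (opposite-injective (fs-injective e))
  lookup-oppositeTail : ∀ i → lookup (x ∷ reverse τ) i ≡ lookup (x ∷ τ) (oppositeTail i)
  lookup-oppositeTail f0 = refl
  lookup-oppositeTail (fs k) = lookup-reverse τ k

∑-allVecs-suc : ∀ m n (h : Vec (Fin n) (suc m) → ℕ) →
                ∑ₗ (allVecs (suc m) n) h ≡ ∑[ x < n ] ∑[ w ∈ allVecs m n ] h (x ∷ w)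
∑-allVecs-suc m n h = begin
  ∑ₗ (concatMap (λ x → List.map (x ∷_) (allVecs m n)) (allFin n)) h
    ≡⟨ ∑ₗ-concatMap _ (allFin n) h ⟩
  ∑[ x ∈ allFin n ] ∑ₗ (List.map (x ∷_) (allVecs m n)) h
    ≡⟨ ∑ₗ-cong (allFin n) (λ x → ∑ₗ-map (x ∷_) (allVecs m n) h) ⟩
  ∑[ x ∈ allFin n ] ∑[ w ∈ allVecs m n ] h (x ∷ w)
    ≡⟨ ∑ₗ-allFin n _ ⟩
  ∑[ x < n ] ∑[ w ∈ allVecs m n ] h (x ∷ w) ∎
  where open ≡-Reasoning

allFin-once : ∀ n (c : Fin n) → ∑[ a ∈ allFin n ] ⟦ does (a ≟ c) ⟧ ≡ 1
allFin-once n c = trans (∑ₗ-allFin n _) (once n c)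
  where
  once : ∀ n (c : Fin n) → ∑[ a < n ] ⟦ does (a ≟ c) ⟧ ≡ 1
  once (suc n) f0 = cong suc (sum-replicate-zero n)
  once (suc n) (fs c) = once n c

allVecs-once : ∀ m n (c : Vec (Fin n) m) → ∑[ v ∈ allVecs m n ] ⟦ does (≡-dec _≟_ v c) ⟧ ≡ 1
allVecs-once zero n [] = refl
allVecs-once (suc m) n (c ∷ cs) = begin
  ∑ₗ (allVecs (suc m) n) (λ v → ⟦ does (≡-dec _≟_ v (c ∷ cs)) ⟧)
    ≡⟨ ∑-allVecs-suc m n _ ⟩
  ∑[ x < n ] ∑[ w ∈ allVecs m n ] ⟦ does (x ≟ c) ∧ does (≡-dec _≟_ w cs) ⟧
    ≡⟨ sum-cong-≗ {n} (λ x → ∑ₗ-cong (allVecs m n) (λ w → ⟦∧⟧ (does (x ≟ c)) _)) ⟩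
  ∑[ x < n ] ∑[ w ∈ allVecs m n ] (⟦ does (x ≟ c) ⟧ * ⟦ does (≡-dec _≟_ w cs) ⟧)
    ≡⟨ sum-cong-≗ {n} (λ x → sym (*-distribˡ-∑ₗ ⟦ does (x ≟ c) ⟧ (allVecs m n) _)) ⟩
  ∑[ x < n ] (⟦ does (x ≟ c) ⟧ * ∑[ w ∈ allVecs m n ] ⟦ does (≡-dec _≟_ w cs) ⟧)
    ≡⟨ sum-cong-≗ {n} (λ x → trans (cong (⟦ does (x ≟ c) ⟧ *_) (allVecs-once m n cs)) (*-identityʳ _)) ⟩
  ∑[ x < n ] ⟦ does (x ≟ c) ⟧
    ≡⟨ sym (∑ₗ-allFin n _) ⟩
  ∑[ x ∈ allFin n ] ⟦ does (x ≟ c) ⟧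
    ≡⟨ allFin-once n c ⟩
  1 ∎
  where open ≡-Reasoning

∑-Sn : ∀ n (h : Vec (Fin n) n → ℕ) → ∑[ π ∈ Sn n ] h π ≡ ∑[ v ∈ allVecs n n ] (⟦ isPerm v ⟧ * h v)
∑-Sn n = ∑ₗ-filter isPerm (allVecs n n)

∑-Sn-cong : ∀ n {h g : Vec (Fin n) n → ℕ} → (∀ π → T (isPerm π) → h π ≡ g π) →
            ∑[ π ∈ Sn n ] h π ≡ ∑[ π ∈ Sn n ] g π
∑-Sn-cong n = ∑ₗ-filter-cong isPerm (allVecs n n)

∑-Sn-involution : ∀ n (f : Vec (Fin n) n → Vec (Fin n) n) →
                  (∀ π → T (isPerm π) → T (isPerm (f π))) → (∀ π → T (isPerm π) → f (f π) ≡ π) →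
                  ∀ h → ∑[ π ∈ Sn n ] h (f π) ≡ ∑[ π ∈ Sn n ] h π
∑-Sn-involution n f perm-f ff h = begin
  ∑[ π ∈ Sn n ] h (f π)                            ≡⟨ ∑-Sn n (h ∘ f) ⟩
  ∑[ v ∈ allVecs n n ] (⟦ isPerm v ⟧ * h (f v))    ≡⟨ ∑ₗ-involution isPerm f perm-f ff h ⟩
  ∑[ v ∈ allVecs n n ] (⟦ isPerm v ⟧ * h v)        ≡⟨ sym (∑-Sn n h) ⟩
  ∑[ π ∈ Sn n ] h π                                ∎
  where
  open ≡-Reasoning
  open Enumeration (≡-dec _≟_) (allVecs n n) (allVecs-once n n)

∑-punchIn : ∀ n (x : Fin (suc n)) (F : Fin (suc n) → ℕ) →
            ∑[ y < suc n ] (⟦ not (does (x ≟ y)) ⟧ * F y) ≡ ∑[ z < n ] F (punchIn x z)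
∑-punchIn n f0 F = sum-cong-≗ {n} (λ z → +-identityʳ (F (fs z)))
∑-punchIn (suc n) (fs x) F = cong₂ _+_ (+-identityʳ (F f0)) (∑-punchIn n x (F ∘ fs))

∑-allVecs-∉ : ∀ m n (x : Fin (suc n)) (g : Vec (Fin (suc n)) m → ℕ) →
              ∑[ w ∈ allVecs m (suc n) ] (⟦ x ∉ᵇ w ⟧ * g w) ≡ ∑[ u ∈ allVecs m n ] g (map (punchIn x) u)
∑-allVecs-∉ zero n x g = +-identityʳ (g [] + 0)
∑-allVecs-∉ (suc m) n x g = begin
  ∑[ w ∈ allVecs (suc m) (suc n) ] (⟦ x ∉ᵇ w ⟧ * g w)
    ≡⟨ ∑-allVecs-suc m (suc n) (λ w → ⟦ x ∉ᵇ w ⟧ * g w) ⟩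
  ∑[ y < suc n ] ∑[ w ∈ allVecs m (suc n) ] (⟦ x≢ y ∧ (x ∉ᵇ w) ⟧ * g (y ∷ w))
    ≡⟨ sum-cong-≗ {suc n} (λ y → ∑ₗ-cong (allVecs m (suc n)) (λ w → split y w)) ⟩
  ∑[ y < suc n ] ∑[ w ∈ allVecs m (suc n) ] (⟦ x≢ y ⟧ * (⟦ x ∉ᵇ w ⟧ * g (y ∷ w)))
    ≡⟨ sum-cong-≗ {suc n} (λ y →
         sym (*-distribˡ-∑ₗ ⟦ x≢ y ⟧ (allVecs m (suc n)) (λ w → ⟦ x ∉ᵇ w ⟧ * g (y ∷ w)))) ⟩
  ∑[ y < suc n ] (⟦ x≢ y ⟧ * ∑[ w ∈ allVecs m (suc n) ] (⟦ x ∉ᵇ w ⟧ * g (y ∷ w)))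
    ≡⟨ sum-cong-≗ {suc n} (λ y → cong (⟦ x≢ y ⟧ *_) (∑-allVecs-∉ m n x (g ∘ (y ∷_)))) ⟩
  ∑[ y < suc n ] (⟦ x≢ y ⟧ * ∑[ u ∈ allVecs m n ] g (y ∷ map (punchIn x) u))
    ≡⟨ ∑-punchIn n x (λ y → ∑[ u ∈ allVecs m n ] g (y ∷ map (punchIn x) u)) ⟩
  ∑[ z < n ] ∑[ u ∈ allVecs m n ] g (punchIn x z ∷ map (punchIn x) u)
    ≡⟨ sym (∑-allVecs-suc m n _) ⟩
  ∑[ u ∈ allVecs (suc m) n ] g (map (punchIn x) u) ∎
  where
  open ≡-Reasoning
  x≢ : Fin (suc n) → Bool
  x≢ y = not (does (x ≟ y))
  split : ∀ y w → ⟦ x≢ y ∧ (x ∉ᵇ w) ⟧ * g (y ∷ w) ≡ ⟦ x≢ y ⟧ * (⟦ x ∉ᵇ w ⟧ * g (y ∷ w))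
  split y w = trans (cong (_* g (y ∷ w)) (⟦∧⟧ (x≢ y) _)) (*-assoc ⟦ x≢ y ⟧ _ _)

∑-Sn-suc : ∀ n (h : Vec (Fin (suc n)) (suc n) → ℕ) →
           ∑[ π ∈ Sn (suc n) ] h π ≡ ∑[ y < suc n ] ∑[ σ ∈ Sn n ] h (y ∷ map (punchIn y) σ)
∑-Sn-suc n h = begin
  ∑[ π ∈ Sn (suc n) ] h π
    ≡⟨ ∑-Sn (suc n) h ⟩
  ∑[ v ∈ allVecs (suc n) (suc n) ] (⟦ isInjective v ⟧ * h v)
    ≡⟨ ∑-allVecs-suc n (suc n) (λ v → ⟦ isInjective v ⟧ * h v) ⟩
  ∑[ y < suc n ] ∑[ w ∈ allVecs n (suc n) ] (⟦ isInjective (y ∷ w) ⟧ * h (y ∷ w))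
    ≡⟨ sum-cong-≗ {suc n} (λ y → ∑ₗ-cong (allVecs n (suc n)) (λ w → split y w)) ⟩
  ∑[ y < suc n ] ∑[ w ∈ allVecs n (suc n) ] (⟦ y ∉ᵇ w ⟧ * (⟦ isInjective w ⟧ * h (y ∷ w)))
    ≡⟨ sum-cong-≗ {suc n} (λ y → ∑-allVecs-∉ n n y (λ w → ⟦ isInjective w ⟧ * h (y ∷ w))) ⟩
  ∑[ y < suc n ] ∑[ u ∈ allVecs n n ] (⟦ isInjective (map (punchIn y) u) ⟧ * h (y ∷ map (punchIn y) u))
    ≡⟨ sum-cong-≗ {suc n} (λ y → ∑ₗ-cong (allVecs n n) (λ u →
         cong (λ b → ⟦ b ⟧ * h (y ∷ map (punchIn y) u)) (isInjective-map (punchIn-injective y _ _) u))) ⟩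
  ∑[ y < suc n ] ∑[ u ∈ allVecs n n ] (⟦ isPerm u ⟧ * h (y ∷ map (punchIn y) u))
    ≡⟨ sum-cong-≗ {suc n} (λ y → sym (∑-Sn n (λ σ → h (y ∷ map (punchIn y) σ)))) ⟩
  ∑[ y < suc n ] ∑[ σ ∈ Sn n ] h (y ∷ map (punchIn y) σ) ∎
  where
  open ≡-Reasoning
  split : ∀ y w → ⟦ isInjective (y ∷ w) ⟧ * h (y ∷ w) ≡ ⟦ y ∉ᵇ w ⟧ * (⟦ isInjective w ⟧ * h (y ∷ w))
  split y w = trans (cong (λ b → ⟦ b ⟧ * h (y ∷ w)) (isInjective-∷ y w))
                    (trans (cong (_* h (y ∷ w)) (⟦∧⟧ (y ∉ᵇ w) _)) (*-assoc ⟦ y ∉ᵇ w ⟧ _ _))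

∑-Sn-suc-∷ʳ : ∀ n (h : Vec (Fin (suc n)) (suc n) → ℕ) →
             ∑[ π ∈ Sn (suc n) ] h π ≡ ∑[ y < suc n ] ∑[ σ ∈ Sn n ] h (map (punchIn y) σ ∷ʳ y)
∑-Sn-suc-∷ʳ n h = begin
  ∑[ π ∈ Sn (suc n) ] h π
    ≡⟨ sym (∑-Sn-involution (suc n) reverse isPerm-reverse (λ π _ → reverse-involutive π) h) ⟩
  ∑[ π ∈ Sn (suc n) ] h (reverse π)
    ≡⟨ ∑-Sn-suc n (h ∘ reverse) ⟩
  ∑[ y < suc n ] ∑[ σ ∈ Sn n ] h (reverse (y ∷ map (punchIn y) σ))
    ≡⟨ sum-cong-≗ {suc n} (λ y → ∑ₗ-cong (Sn n) (λ σ → cong h (begin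
         reverse (y ∷ map (punchIn y) σ)   ≡⟨ reverse-∷ y (map (punchIn y) σ) ⟩
         reverse (map (punchIn y) σ) ∷ʳ y  ≡⟨ cong (_∷ʳ y) (sym (map-reverse (punchIn y) σ)) ⟩
         map (punchIn y) (reverse σ) ∷ʳ y  ∎))) ⟩
  ∑[ y < suc n ] ∑[ σ ∈ Sn n ] h (map (punchIn y) (reverse σ) ∷ʳ y)
    ≡⟨ sum-cong-≗ {suc n} (λ y → ∑-Sn-involution n reverse isPerm-reverse (λ σ _ → reverse-involutive σ)
                                   (λ σ → h (map (punchIn y) σ ∷ʳ y))) ⟩
  ∑[ y < suc n ] ∑[ σ ∈ Sn n ] h (map (punchIn y) σ ∷ʳ y) ∎
  where open ≡-Reasoning

-- Occurrences of mesh patterns and their symmetries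

inBand : ℕ → ℕ → ℕ → Fin 3 → ℕ → Bool
inBand n u w c x = coord n u w (toℕ c) <ᵇ x <ᵇ coord n u w (suc (toℕ c))

inCell : ∀ {n} → Vec (Fin n) n → Fin n → Fin n → Fin 3 × Fin 3 → Fin n → Bool
inCell {n} π i j (a , b) k =
  inBand n (suc (toℕ i)) (suc (toℕ j)) a (suc (toℕ k)) ∧ inBand n (val π i) (val π j) b (val π k)

isEmptyCell : ∀ {n} → Vec (Fin n) n → Fin n → Fin n → Fin 3 × Fin 3 → Bool
isEmptyCell {n} π i j cell = not (any (inCell π i j cell) (allFin n))

isOcc-isEmptyCell : ∀ {n} R (π : Vec (Fin n) n) i j →
  isOcc R π i j ≡ (suc (toℕ i) <ᵇ suc (toℕ j)) ∧ (val π i <ᵇ val π j) ∧ all (isEmptyCell π i j) R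
isOcc-isEmptyCell R π i j = refl

T-isEmptyCell : ∀ {n} (π : Vec (Fin n) n) i j c → T (isEmptyCell π i j c) ⇔ (∀ k → ¬ T (inCell π i j c k))
T-isEmptyCell π i j c = mk⇔
  (λ t k inₖ → T-not⁻ t (Equivalence.from (T-any-allFin _) (k , inₖ)))
  (λ h → T-not λ t → let (k , inₖ) = Equivalence.to (T-any-allFin _) t in h k inₖ)

occ-∑ : ∀ {n} R (π : Vec (Fin n) n) → occ R π ≡ ∑[ i < n ] ∑[ j < n ] ⟦ isOcc R π i j ⟧
occ-∑ {n} R π = begin
  occ R π
    ≡⟨ length-concatMap _ (allFin n) ⟩
  ∑[ i ∈ allFin n ] length (filter (λ j → T? (isOcc R π i j)) (allFin n))
    ≡⟨ ∑ₗ-cong (allFin n) (λ i → length-filter (isOcc R π i) (allFin n)) ⟩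
  ∑[ i ∈ allFin n ] ∑[ j ∈ allFin n ] ⟦ isOcc R π i j ⟧
    ≡⟨ ∑ₗ-allFin n _ ⟩
  ∑[ i < n ] ∑[ j ∈ allFin n ] ⟦ isOcc R π i j ⟧
    ≡⟨ sum-cong-≗ {n} (λ i → ∑ₗ-allFin n _) ⟩
  ∑[ i < n ] ∑[ j < n ] ⟦ isOcc R π i j ⟧ ∎
  where open ≡-Reasoning

s-∑ : ∀ R n k → s R n k ≡ ∑[ π ∈ Sn n ] ⟦ occ R π ≡ᵇ k ⟧
s-∑ R n k = length-filter (λ π → occ R π ≡ᵇ k) (Sn n)

s-involution : ∀ R R′ n (f : Vec (Fin n) n → Vec (Fin n) n) →
               (∀ π → T (isPerm π) → T (isPerm (f π))) → (∀ π → T (isPerm π) → f (f π) ≡ π) →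
               (∀ π → T (isPerm π) → occ R′ (f π) ≡ occ R π) → ∀ k → s R′ n k ≡ s R n k
s-involution R R′ n f perm-f ff occ-f k = begin
  s R′ n k
    ≡⟨ s-∑ R′ n k ⟩
  ∑[ π ∈ Sn n ] ⟦ occ R′ π ≡ᵇ k ⟧
    ≡⟨ sym (∑-Sn-involution n f perm-f ff (λ π → ⟦ occ R′ π ≡ᵇ k ⟧)) ⟩
  ∑[ π ∈ Sn n ] ⟦ occ R′ (f π) ≡ᵇ k ⟧
    ≡⟨ ∑-Sn-cong n (λ π perm → cong (λ m → ⟦ m ≡ᵇ k ⟧) (occ-f π perm)) ⟩
  ∑[ π ∈ Sn n ] ⟦ occ R π ≡ᵇ k ⟧
    ≡⟨ sym (s-∑ R n k) ⟩
  s R n k ∎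
  where open ≡-Reasoning

s-reverse : ∀ R n k → s (List.reverse R) n k ≡ s R n k
s-reverse R n = s-involution R (List.reverse R) n id (λ _ perm → perm) (λ _ _ → refl) λ π _ → begin
  occ (List.reverse R) π
    ≡⟨ occ-∑ (List.reverse R) π ⟩
  ∑[ i < n ] ∑[ j < n ] ⟦ isOcc (List.reverse R) π i j ⟧
    ≡⟨ sum-cong-≗ {n} (λ i → sum-cong-≗ {n} λ j → cong ⟦_⟧ (reorder π i j)) ⟩
  ∑[ i < n ] ∑[ j < n ] ⟦ isOcc R π i j ⟧
    ≡⟨ sym (occ-∑ R π) ⟩
  occ R π ∎
  where
  open ≡-Reasoning
  reorder : ∀ π i j → isOcc (List.reverse R) π i j ≡ isOcc R π i j
  reorder π i j = begin
    isOcc (List.reverse R) π i j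
      ≡⟨ isOcc-isEmptyCell (List.reverse R) π i j ⟩
    (suc (toℕ i) <ᵇ suc (toℕ j)) ∧ (val π i <ᵇ val π j) ∧ all (isEmptyCell π i j) (List.reverse R)
      ≡⟨ cong (λ b → (suc (toℕ i) <ᵇ suc (toℕ j)) ∧ (val π i <ᵇ val π j) ∧ b)
              (all-reverse (isEmptyCell π i j) R) ⟩
    (suc (toℕ i) <ᵇ suc (toℕ j)) ∧ (val π i <ᵇ val π j) ∧ all (isEmptyCell π i j) R
      ≡⟨ sym (isOcc-isEmptyCell R π i j) ⟩
    isOcc R π i j ∎

module Transpose {n} (π : Vec (Fin n) n) (perm : T (isPerm π)) where

  private
    σ : Vec (Fin n) n
    σ = inverse π

  inCell-transpose : ∀ i j a b k → inCell σ (lookup π i) (lookup π j) (b , a) (lookup π k) ≡ inCell π i j (a , b) k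
  inCell-transpose i j a b k rewrite inverseˡ π perm i | inverseˡ π perm j | inverseˡ π perm k =
    ∧-comm (inBand n (val π i) (val π j) b (val π k)) _

  isEmptyCell-transpose : ∀ i j c → isEmptyCell σ (lookup π i) (lookup π j) (swap c) ≡ isEmptyCell π i j c
  isEmptyCell-transpose i j (a , b) = cong not (begin
    any (inCell σ (lookup π i) (lookup π j) (b , a)) (allFin n)
      ≡⟨ sym (any-allFin-reindex _ (lookup π) (λ k → lookup σ k , inverseʳ π perm k)) ⟩
    any (inCell σ (lookup π i) (lookup π j) (b , a) ∘ lookup π) (allFin n)
      ≡⟨ cong or (map-cong (inCell-transpose i j a b) (allFin n)) ⟩
    any (inCell π i j (a , b)) (allFin n) ∎)
    where open ≡-Reasoning

  isOcc-transpose : ∀ R i j → isOcc (List.map swap R) σ (lookup π i) (lookup π j) ≡ isOcc R π i j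
  isOcc-transpose R i j = begin
    isOcc (List.map swap R) σ (lookup π i) (lookup π j)
      ≡⟨ isOcc-isEmptyCell (List.map swap R) σ (lookup π i) (lookup π j) ⟩
    (val π i <ᵇ val π j) ∧ (val σ (lookup π i) <ᵇ val σ (lookup π j)) ∧
      all (isEmptyCell σ (lookup π i) (lookup π j)) (List.map swap R)
      ≡⟨ cong₂ (λ x b → (val π i <ᵇ val π j) ∧ x ∧ b)
               (cong₂ (λ i′ j′ → suc (toℕ i′) <ᵇ suc (toℕ j′)) (inverseˡ π perm i) (inverseˡ π perm j))
               (trans (all-map _ swap R) (all-cong (isEmptyCell-transpose i j) R)) ⟩
    (val π i <ᵇ val π j) ∧ (suc (toℕ i) <ᵇ suc (toℕ j)) ∧ all (isEmptyCell π i j) R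
      ≡⟨ ∧-swapˡ (val π i <ᵇ val π j) (suc (toℕ i) <ᵇ suc (toℕ j)) _ ⟩
    (suc (toℕ i) <ᵇ suc (toℕ j)) ∧ (val π i <ᵇ val π j) ∧ all (isEmptyCell π i j) R
      ≡⟨ sym (isOcc-isEmptyCell R π i j) ⟩
    isOcc R π i j ∎
    where open ≡-Reasoning

  occ-transpose : ∀ R → occ (List.map swap R) σ ≡ occ R π
  occ-transpose R = begin
    occ (List.map swap R) σ
      ≡⟨ occ-∑ (List.map swap R) σ ⟩
    ∑[ i < n ] ∑[ j < n ] ⟦ isOcc (List.map swap R) σ i j ⟧
      ≡⟨ sym (∑-reindex (lookup π) (lookup σ) (inverseʳ π perm) (inverseˡ π perm)
               (λ i → ∑[ j < n ] ⟦ isOcc (List.map swap R) σ i j ⟧)) ⟩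
    ∑[ i < n ] ∑[ j < n ] ⟦ isOcc (List.map swap R) σ (lookup π i) j ⟧
      ≡⟨ sum-cong-≗ {n} (λ i → sym (∑-reindex (lookup π) (lookup σ) (inverseʳ π perm) (inverseˡ π perm)
                                     (λ j → ⟦ isOcc (List.map swap R) σ (lookup π i) j ⟧))) ⟩
    ∑[ i < n ] ∑[ j < n ] ⟦ isOcc (List.map swap R) σ (lookup π i) (lookup π j) ⟧
      ≡⟨ sum-cong-≗ {n} (λ i → sum-cong-≗ {n} (λ j → cong ⟦_⟧ (isOcc-transpose R i j))) ⟩
    ∑[ i < n ] ∑[ j < n ] ⟦ isOcc R π i j ⟧
      ≡⟨ sym (occ-∑ R π) ⟩
    occ R π ∎
    where open ≡-Reasoning

s-transpose : ∀ R n k → s (List.map swap R) n k ≡ s R n k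
s-transpose R n = s-involution R (List.map swap R) n inverse isPerm-inverse inverse-involutive
  (λ π perm → Transpose.occ-transpose π perm R)

∸-<ᵇ-∸ : ∀ N p q → p ≤ N → (N ∸ p <ᵇ N ∸ q) ≡ (q <ᵇ p)
∸-<ᵇ-∸ N p q p≤N = T-extensional (mk⇔
  (λ t → <⇒<ᵇ (∸-cancelʳ-< {p} {q} {N} (<ᵇ⇒< (N ∸ p) (N ∸ q) t)))
  (λ t → <⇒<ᵇ (∸-monoʳ-< (<ᵇ⇒< q p t) p≤N)))

coord-≤ : ∀ n {u w} → u ≤ suc n → w ≤ suc n → ∀ c → coord n u w c ≤ suc n
coord-≤ n u≤ w≤ zero = z≤n
coord-≤ n u≤ w≤ (suc zero) = u≤
coord-≤ n u≤ w≤ (suc (suc zero)) = w≤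
coord-≤ n u≤ w≤ (suc (suc (suc c))) = ≤-refl

coord-opposite : ∀ n u w (c : Fin 3) →
                 coord n (suc n ∸ w) (suc n ∸ u) (toℕ (opposite c)) ≡ suc n ∸ coord n u w (suc (toℕ c))
coord-opposite n u w c0 = refl
coord-opposite n u w c1 = refl
coord-opposite n u w c2 = sym (n∸n≡0 n)

coord-opposite-suc : ∀ n u w (c : Fin 3) →
                     coord n (suc n ∸ w) (suc n ∸ u) (suc (toℕ (opposite c))) ≡ suc n ∸ coord n u w (toℕ c)
coord-opposite-suc n u w c0 = refl
coord-opposite-suc n u w c1 = refl
coord-opposite-suc n u w c2 = refl

inBand-opposite : ∀ n {u w x} (c : Fin 3) → u ≤ suc n → w ≤ suc n → x ≤ suc n →
                  inBand n (suc n ∸ w) (suc n ∸ u) (opposite c) (suc n ∸ x) ≡ inBand n u w c x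
inBand-opposite n {u} {w} {x} c u≤ w≤ x≤ = begin
  inBand n (suc n ∸ w) (suc n ∸ u) (opposite c) (suc n ∸ x)
    ≡⟨ cong₂ (λ lo′ hi′ → lo′ <ᵇ suc n ∸ x <ᵇ hi′) (coord-opposite n u w c) (coord-opposite-suc n u w c) ⟩
  (suc n ∸ hi <ᵇ suc n ∸ x) ∧ (suc n ∸ x <ᵇ suc n ∸ lo)
    ≡⟨ cong₂ _∧_ (∸-<ᵇ-∸ (suc n) hi x (coord-≤ n u≤ w≤ (suc (toℕ c)))) (∸-<ᵇ-∸ (suc n) x lo x≤) ⟩
  (x <ᵇ hi) ∧ (lo <ᵇ x)
    ≡⟨ ∧-comm (x <ᵇ hi) _ ⟩
  inBand n u w c x ∎
  where
  open ≡-Reasoning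
  lo hi : ℕ
  lo = coord n u w (toℕ c)
  hi = coord n u w (suc (toℕ c))

rotateCell : Fin 3 × Fin 3 → Fin 3 × Fin 3
rotateCell = ×-map opposite opposite

suc-toℕ-≤ : ∀ {n} (k : Fin n) → suc (toℕ k) ≤ suc n
suc-toℕ-≤ k = m≤n⇒m≤1+n (toℕ<n k)

suc-opposite : ∀ {n} (k : Fin n) → suc (toℕ (opposite k)) ≡ suc n ∸ suc (toℕ k)
suc-opposite {n} k = trans (cong suc (opposite-prop k)) (sym (+-∸-assoc 1 (toℕ<n k)))

module Rotate {n} (π : Vec (Fin n) n) where

  private
    ρ : Vec (Fin n) n
    ρ = rotate π

  val-rotate : ∀ k → val ρ (opposite k) ≡ suc n ∸ val π k
  val-rotate k = begin
    suc (toℕ (lookup ρ (opposite k)))                       ≡⟨ cong (suc ∘ toℕ) (lookup-rotate π (opposite k)) ⟩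
    suc (toℕ (opposite (lookup π (opposite (opposite k))))) ≡⟨ cong (λ k′ → suc (toℕ (opposite (lookup π k′))))
                                                                    (opposite-involutive k) ⟩
    suc (toℕ (opposite (lookup π k)))                       ≡⟨ suc-opposite (lookup π k) ⟩
    suc n ∸ val π k                                         ∎
    where open ≡-Reasoning

  inCell-rotate : ∀ i j c k → inCell ρ (opposite j) (opposite i) (rotateCell c) (opposite k) ≡ inCell π i j c k
  inCell-rotate i j (a , b) k
    rewrite suc-opposite i | suc-opposite j | suc-opposite k | val-rotate i | val-rotate j | val-rotate k =
    cong₂ _∧_ (inBand-opposite n a (suc-toℕ-≤ i) (suc-toℕ-≤ j) (suc-toℕ-≤ k))
              (inBand-opposite n b (suc-toℕ-≤ (lookup π i)) (suc-toℕ-≤ (lookup π j)) (suc-toℕ-≤ (lookup π k)))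

  isEmptyCell-rotate : ∀ i j c → isEmptyCell ρ (opposite j) (opposite i) (rotateCell c) ≡ isEmptyCell π i j c
  isEmptyCell-rotate i j c = cong not (begin
    any (inCell ρ (opposite j) (opposite i) (rotateCell c)) (allFin n)
      ≡⟨ sym (any-allFin-reindex (inCell ρ (opposite j) (opposite i) (rotateCell c)) opposite
                                 (λ k → opposite k , opposite-involutive k)) ⟩
    any (inCell ρ (opposite j) (opposite i) (rotateCell c) ∘ opposite) (allFin n)
      ≡⟨ cong or (map-cong (inCell-rotate i j c) (allFin n)) ⟩
    any (inCell π i j c) (allFin n) ∎)
    where open ≡-Reasoning

  isOcc-rotate : ∀ R i j → isOcc (List.map rotateCell R) ρ (opposite j) (opposite i) ≡ isOcc R π i j
  isOcc-rotate R i j = begin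
    isOcc (List.map rotateCell R) ρ (opposite j) (opposite i)
      ≡⟨ isOcc-isEmptyCell (List.map rotateCell R) ρ (opposite j) (opposite i) ⟩
    (suc (toℕ (opposite j)) <ᵇ suc (toℕ (opposite i))) ∧ (val ρ (opposite j) <ᵇ val ρ (opposite i)) ∧
      all (isEmptyCell ρ (opposite j) (opposite i)) (List.map rotateCell R)
      ≡⟨ cong₂ _∧_ (trans (cong₂ _<ᵇ_ (suc-opposite j) (suc-opposite i))
                          (∸-<ᵇ-∸ (suc n) (suc (toℕ j)) (suc (toℕ i)) (suc-toℕ-≤ j)))
           (cong₂ _∧_ (trans (cong₂ _<ᵇ_ (val-rotate j) (val-rotate i))
                             (∸-<ᵇ-∸ (suc n) (val π j) (val π i) (suc-toℕ-≤ (lookup π j))))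
                      (trans (all-map (isEmptyCell ρ (opposite j) (opposite i)) rotateCell R)
                             (all-cong (isEmptyCell-rotate i j) R))) ⟩
    (suc (toℕ i) <ᵇ suc (toℕ j)) ∧ (val π i <ᵇ val π j) ∧ all (isEmptyCell π i j) R
      ≡⟨ sym (isOcc-isEmptyCell R π i j) ⟩
    isOcc R π i j ∎
    where open ≡-Reasoning

  occ-rotate : ∀ R → occ (List.map rotateCell R) ρ ≡ occ R π
  occ-rotate R = begin
    occ (List.map rotateCell R) ρ
      ≡⟨ occ-∑ (List.map rotateCell R) ρ ⟩
    ∑[ i < n ] ∑[ j < n ] ⟦ isOcc (List.map rotateCell R) ρ i j ⟧
      ≡⟨ sym (∑-reindex opposite opposite opposite-involutive opposite-involutive
               (λ i → ∑[ j < n ] ⟦ isOcc (List.map rotateCell R) ρ i j ⟧)) ⟩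
    ∑[ j < n ] ∑[ i < n ] ⟦ isOcc (List.map rotateCell R) ρ (opposite j) i ⟧
      ≡⟨ sum-cong-≗ {n} (λ j → sym (∑-reindex opposite opposite opposite-involutive opposite-involutive
                                     (λ i → ⟦ isOcc (List.map rotateCell R) ρ (opposite j) i ⟧))) ⟩
    ∑[ j < n ] ∑[ i < n ] ⟦ isOcc (List.map rotateCell R) ρ (opposite j) (opposite i) ⟧
      ≡⟨ sum-cong-≗ {n} (λ j → sum-cong-≗ {n} (λ i → cong ⟦_⟧ (isOcc-rotate R i j))) ⟩
    ∑[ j < n ] ∑[ i < n ] ⟦ isOcc R π i j ⟧
      ≡⟨ ∑-comm (λ j i → ⟦ isOcc R π i j ⟧) ⟩
    ∑[ i < n ] ∑[ j < n ] ⟦ isOcc R π i j ⟧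
      ≡⟨ sym (occ-∑ R π) ⟩
    occ R π ∎
    where open ≡-Reasoning

s-rotate : ∀ R n k → s (List.map rotateCell R) n k ≡ s R n k
s-rotate R n = s-involution R (List.map rotateCell R) n rotate isPerm-rotate (λ π _ → rotate-involutive π)
  (λ π _ → Rotate.occ-rotate π R)

-- Meshes with a shaded first column

column₀ : Fin 3 × Fin 3 → Mesh
column₀ cell = (c0 , c2) ∷ (c0 , c1) ∷ (c0 , c0) ∷ cell ∷ []

-- The entry π₁ lies left of the pair and, being distinct from both of its values, in a cell of column 0.
isOcc-column₀-suc : ∀ {n} cell (π : Vec (Fin (suc n)) (suc n)) → T (isPerm π) →
                    ∀ i j → isOcc (column₀ cell) π (fs i) j ≡ false
isOcc-column₀-suc {n} cell π perm i j = ¬T⇒≡false λ t →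
  let (i<j , t₁) = T-∧⁻ (suc (toℕ i) <ᵇ toℕ j) t
      (_ , t₂) = T-∧⁻ (b <ᵇ c) t₁
      (e₀₂ , t₃) = T-∧⁻ (E (c0 , c2)) t₂
      (e₀₁ , t₄) = T-∧⁻ (E (c0 , c1)) t₃
      (e₀₀ , _) = T-∧⁻ (E (c0 , c0)) t₄
      empty : ∀ cell → T (E cell) → ¬ T (inCell π (fs i) j cell f0)
      empty cell e = Equivalence.to (T-isEmptyCell π (fs i) j cell) e f0
  in cases (<-cmp a b) (<-cmp a c) i<j (empty (c0 , c0) e₀₀) (empty (c0 , c1) e₀₁) (empty (c0 , c2) e₀₂)
  where
  a b c : ℕ
  a = toℕ (lookup π f0)
  b = toℕ (lookup π (fs i))
  c = toℕ (lookup π j)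
  E : Fin 3 × Fin 3 → Bool
  E = isEmptyCell π (fs i) j
  inj : Injective _≡_ _≡_ (lookup π)
  inj = Equivalence.to (T-isInjective π) perm
  cases : Tri (a < b) (a ≡ b) (b < a) → Tri (a < c) (a ≡ c) (c < a) → T (suc (toℕ i) <ᵇ toℕ j) →
          ¬ T (a <ᵇ b) → ¬ T ((b <ᵇ a) ∧ (a <ᵇ c)) → ¬ T ((c <ᵇ a) ∧ (a <ᵇ suc n)) → ⊥
  cases (tri< a<b _ _) _ _ ¬₀₀ _ _ = ¬₀₀ (<⇒<ᵇ a<b)
  cases (tri≈ _ a≡b _) _ _ _ _ _ = 0≢1+n (inj (toℕ-injective a≡b))
  cases (tri> _ _ a>b) (tri< a<c _ _) _ _ ¬₀₁ _ = ¬₀₁ (Equivalence.from T-∧ (<⇒<ᵇ a>b , <⇒<ᵇ a<c))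
  cases (tri> _ _ _) (tri≈ _ a≡c _) i<j _ _ _ with inj (toℕ-injective a≡c)
  ... | refl = i<j
  cases (tri> _ _ _) (tri> _ _ a>c) _ _ _ ¬₀₂ = ¬₀₂ (Equivalence.from T-∧ (<⇒<ᵇ a>c , <⇒<ᵇ (toℕ<n (lookup π f0))))

isOcc-column₀-head : ∀ {n} cell (x : Fin (suc n)) (τ : Vec (Fin (suc n)) n) j →
                     isOcc (column₀ cell) (x ∷ τ) f0 (fs j) ≡
                     (toℕ x <ᵇ toℕ (lookup τ j)) ∧ isEmptyCell (x ∷ τ) f0 (fs j) cell
isOcc-column₀-head {n} cell x τ j
  rewrite any-false (allFin (suc n)) = cong (_ ∧_) (∧-identityʳ (isEmptyCell (x ∷ τ) f0 (fs j) cell))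

occ-column₀ : ∀ {n} cell (x : Fin (suc n)) (τ : Vec (Fin (suc n)) n) → T (isPerm (x ∷ τ)) →
              occ (column₀ cell) (x ∷ τ) ≡ ∑[ j < n ] ⟦ isOcc (column₀ cell) (x ∷ τ) f0 (fs j) ⟧
occ-column₀ {n} cell x τ perm = begin
  occ R π
    ≡⟨ occ-∑ R π ⟩
  ∑[ j < n ] ⟦ isOcc R π f0 (fs j) ⟧ + ∑[ i < n ] ∑[ j < suc n ] ⟦ isOcc R π (fs i) j ⟧
    ≡⟨ cong (∑[ j < n ] ⟦ isOcc R π f0 (fs j) ⟧ +_) (trans
         (sum-cong-≗ {n} (λ i → sum-cong-≗ {suc n} (λ j → cong ⟦_⟧ (isOcc-column₀-suc cell π perm i j))))
         (trans (sum-cong-≗ {n} (λ i → sum-replicate-zero (suc n))) (sum-replicate-zero n))) ⟩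
  ∑[ j < n ] ⟦ isOcc R π f0 (fs j) ⟧ + 0
    ≡⟨ +-identityʳ _ ⟩
  ∑[ j < n ] ⟦ isOcc R π f0 (fs j) ⟧ ∎
  where
  open ≡-Reasoning
  R : Mesh
  R = column₀ cell
  π : Vec (Fin (suc n)) (suc n)
  π = x ∷ τ

module HeadOccurrences {n} (x : Fin (suc n)) (τ : Vec (Fin (suc n)) n) (perm : T (isPerm (x ∷ τ))) where

  Above : Fin n → Set
  Above k = toℕ x < toℕ (lookup τ k)

  private
    π : Vec (Fin (suc n)) (suc n)
    π = x ∷ τ

    not-below⇒above : ∀ k → ¬ T (toℕ (lookup τ k) <ᵇ toℕ x) → Above k
    not-below⇒above k ¬below = ≤∧≢⇒< (≮⇒≥ (¬below ∘ <⇒<ᵇ))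
      λ x≡τk → 0≢1+n (Equivalence.to (T-isInjective π) perm (toℕ-injective x≡τk))

    T-isOcc-head : ∀ cell j → T (isOcc (column₀ cell) π f0 (fs j)) ⇔ (Above j × (∀ k → ¬ T (inCell π f0 (fs j) cell k)))
    T-isOcc-head cell j = mk⇔
      (λ t → let (x<τj , e) = T-∧⁻ (toℕ x <ᵇ toℕ (lookup τ j)) (subst T (isOcc-column₀-head cell x τ j) t)
             in <ᵇ⇒< _ _ x<τj , Equivalence.to (T-isEmptyCell π f0 (fs j) cell) e)
      (λ { (x<τj , e) → subst T (sym (isOcc-column₀-head cell x τ j))
             (Equivalence.from T-∧ (<⇒<ᵇ x<τj , Equivalence.from (T-isEmptyCell π f0 (fs j) cell) e)) })

  T-isOcc-prefix : ∀ j → T (isOcc (column₀ (c1 , c0)) π f0 (fs j)) ⇔ (∀ k → toℕ k ≤ toℕ j → Above k)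
  T-isOcc-prefix j = mk⇔
    (λ t k k≤j → let (x<τj , e) = Equivalence.to (T-isOcc-head (c1 , c0) j) t in
       [ (λ k<j → not-below⇒above k λ below → e (fs k) (Equivalence.from T-∧ (<⇒<ᵇ k<j , below)))
       , (λ k≡j → subst Above (sym (toℕ-injective k≡j)) x<τj)
       ] (m≤n⇒m<n∨m≡n k≤j))
    (λ h → Equivalence.from (T-isOcc-head (c1 , c0) j)
       (h j ≤-refl , λ { (fs k) t → let (k<j , below) = T-∧⁻ (toℕ k <ᵇ toℕ j) t in
                                    <-asym (<ᵇ⇒< _ _ below) (h k (<⇒≤ (<ᵇ⇒< _ _ k<j))) }))

  T-isOcc-suffix : ∀ j → T (isOcc (column₀ (c2 , c0)) π f0 (fs j)) ⇔ (∀ k → toℕ j ≤ toℕ k → Above k)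
  T-isOcc-suffix j = mk⇔
    (λ t k j≤k → let (x<τj , e) = Equivalence.to (T-isOcc-head (c2 , c0) j) t in
       [ (λ j<k → not-below⇒above k λ below →
           e (fs k) (Equivalence.from T-∧ (Equivalence.from T-∧ (<⇒<ᵇ j<k , <⇒<ᵇ (toℕ<n k)) , below)))
       , (λ j≡k → subst Above (toℕ-injective j≡k) x<τj)
       ] (m≤n⇒m<n∨m≡n j≤k))
    (λ h → Equivalence.from (T-isOcc-head (c2 , c0) j)
       (h j ≤-refl , λ { (fs k) t → let (j<k∧k<n , below) = T-∧⁻ ((toℕ j <ᵇ toℕ k) ∧ (toℕ k <ᵇ n)) t
                                        (j<k , _) = T-∧⁻ (toℕ j <ᵇ toℕ k) j<k∧k<n in
                                    <-asym (<ᵇ⇒< _ _ below) (h k (<⇒≤ (<ᵇ⇒< _ _ j<k))) }))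

prefixLength : ∀ {A : Set} {m} → (A → Bool) → Vec A m → ℕ
prefixLength p [] = 0
prefixLength p (y ∷ τ) = if p y then suc (prefixLength p τ) else 0

∑-prefix : ∀ {A : Set} {m} (p : A → Bool) (τ : Vec A m) (c : Fin m → Bool) →
           (∀ j → T (c j) ⇔ (∀ k → toℕ k ≤ toℕ j → T (p (lookup τ k)))) →
           ∑[ j < m ] ⟦ c j ⟧ ≡ prefixLength p τ
∑-prefix p [] c c⇔ = refl
∑-prefix {m = suc m} p (y ∷ τ) c c⇔ with p y in py
... | true = cong₂ _+_ (cong ⟦_⟧ (Equivalence.to T-≡ (Equivalence.from (c⇔ f0) λ { f0 _ → subst T (sym py) tt })))
                       (∑-prefix p τ (c ∘ fs) λ j → mk⇔
                         (λ t k k≤j → Equivalence.to (c⇔ (fs j)) t (fs k) (s≤s k≤j))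
                         (λ h → Equivalence.from (c⇔ (fs j))
                                  λ { f0 _ → subst T (sym py) tt ; (fs k) (s≤s k≤j) → h k k≤j }))
... | false = trans (sum-cong-≗ {suc m} λ j → cong ⟦_⟧ (¬T⇒≡false λ t → subst T py (Equivalence.to (c⇔ j) t f0 z≤n)))
                    (sum-replicate-zero (suc m))

headRun : ∀ {m n} → Vec (Fin n) (suc m) → ℕ
headRun (x ∷ τ) = prefixLength (λ y → toℕ x <ᵇ toℕ y) τ

occ-column₀-headRun : ∀ {n} (π : Vec (Fin (suc n)) (suc n)) → T (isPerm π) → occ (column₀ (c1 , c0)) π ≡ headRun π
occ-column₀-headRun (x ∷ τ) perm = trans (occ-column₀ (c1 , c0) x τ perm) (∑-prefix _ τ _ λ j → mk⇔
  (λ t k k≤j → <⇒<ᵇ (Equivalence.to (T-isOcc-prefix j) t k k≤j))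
  (λ h → Equivalence.from (T-isOcc-prefix j) λ k k≤j → <ᵇ⇒< _ _ (h k k≤j)))
  where open HeadOccurrences x τ perm

occ-reverseTail : ∀ {n} (π : Vec (Fin n) n) → T (isPerm π) →
                  occ (column₀ (c2 , c0)) π ≡ occ (column₀ (c1 , c0)) (reverseTail π)
occ-reverseTail [] _ = refl
occ-reverseTail {suc n} (x ∷ τ) perm = begin
  occ (column₀ (c2 , c0)) (x ∷ τ)
    ≡⟨ occ-column₀ (c2 , c0) x τ perm ⟩
  ∑[ j < n ] ⟦ isOcc (column₀ (c2 , c0)) (x ∷ τ) f0 (fs j) ⟧
    ≡⟨ sum-cong-≗ {n} (λ j → cong ⟦_⟧ (T-extensional (suffix⇔prefix j))) ⟩
  ∑[ j < n ] ⟦ isOcc (column₀ (c1 , c0)) (x ∷ reverse τ) f0 (fs (opposite j)) ⟧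
    ≡⟨ ∑-reindex opposite opposite opposite-involutive opposite-involutive
         (λ j → ⟦ isOcc (column₀ (c1 , c0)) (x ∷ reverse τ) f0 (fs j) ⟧) ⟩
  ∑[ j < n ] ⟦ isOcc (column₀ (c1 , c0)) (x ∷ reverse τ) f0 (fs j) ⟧
    ≡⟨ sym (occ-column₀ (c1 , c0) x (reverse τ) perm′) ⟩
  occ (column₀ (c1 , c0)) (x ∷ reverse τ) ∎
  where
  open ≡-Reasoning
  perm′ : T (isPerm (x ∷ reverse τ))
  perm′ = isPerm-reverseTail (x ∷ τ) perm
  module H = HeadOccurrences x τ perm
  module H′ = HeadOccurrences x (reverse τ) perm′
  suffix⇔prefix : ∀ j → T (isOcc (column₀ (c2 , c0)) (x ∷ τ) f0 (fs j)) ⇔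
                        T (isOcc (column₀ (c1 , c0)) (x ∷ reverse τ) f0 (fs (opposite j)))
  suffix⇔prefix j = mk⇔
    (λ t → Equivalence.from (H′.T-isOcc-prefix (opposite j)) λ k k≤j′ →
       subst (λ c → toℕ x < toℕ c) (sym (lookup-reverse τ k))
         (Equivalence.to (H.T-isOcc-suffix j) t (opposite k)
           (subst (λ i → toℕ i ≤ toℕ (opposite k)) (opposite-involutive j) (opposite-antitone k≤j′))))
    (λ t → Equivalence.from (H.T-isOcc-suffix j) λ k j≤k →
       subst (λ c → toℕ x < toℕ c) (trans (lookup-reverse τ (opposite k)) (cong (lookup τ) (opposite-involutive k)))
         (Equivalence.to (H′.T-isOcc-prefix (opposite j)) t (opposite k) (opposite-antitone j≤k)))

s-reverseTail : ∀ n k → s (column₀ (c2 , c0)) n k ≡ s (column₀ (c1 , c0)) n k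
s-reverseTail n = s-involution (column₀ (c1 , c0)) (column₀ (c2 , c0)) n reverseTail isPerm-reverseTail
  (λ π _ → reverseTail-involutive π)
  (λ π perm → trans (occ-reverseTail (reverseTail π) (isPerm-reverseTail π perm))
                    (cong (occ (column₀ (c1 , c0))) (reverseTail-involutive π)))

-- Counting permutations by the run after the first entry

module _ {A : Set} (p : A → Bool) where

  prefixLength-≤ : ∀ {m} (τ : Vec A m) → prefixLength p τ ≤ m
  prefixLength-≤ [] = z≤n
  prefixLength-≤ (y ∷ τ) with p y
  ... | true = s≤s (prefixLength-≤ τ)
  ... | false = z≤n

  prefixLength-full : ∀ {m} (τ : Vec A m) → prefixLength p τ ≡ m → ∀ k → T (p (lookup τ k))
  prefixLength-full (y ∷ τ) full k with p y in py
  prefixLength-full (y ∷ τ) full f0 | true = subst T (sym py) tt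
  prefixLength-full (y ∷ τ) full (fs k) | true = prefixLength-full τ (suc-injective full) k

  prefixLength-∷ʳ-full : ∀ {m} (τ : Vec A m) y → prefixLength p τ ≡ m → prefixLength p (τ ∷ʳ y) ≡ m + ⟦ p y ⟧
  prefixLength-∷ʳ-full [] y _ with p y
  ... | true = refl
  ... | false = refl
  prefixLength-∷ʳ-full (z ∷ τ) y full with p z
  ... | true = cong suc (prefixLength-∷ʳ-full τ y (suc-injective full))

  prefixLength-∷ʳ-short : ∀ {m} (τ : Vec A m) y → prefixLength p τ ≢ m → prefixLength p (τ ∷ʳ y) ≡ prefixLength p τ
  prefixLength-∷ʳ-short [] y short = ⊥-elim (short refl)
  prefixLength-∷ʳ-short (z ∷ τ) y short with p z
  ... | true = cong suc (prefixLength-∷ʳ-short τ y (short ∘ cong suc))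
  ... | false = refl

prefixLength-map : ∀ {A B : Set} {m} (p : B → Bool) (f : A → B) (q : A → Bool) → (∀ a → p (f a) ≡ q a) →
                   (τ : Vec A m) → prefixLength p (map f τ) ≡ prefixLength q τ
prefixLength-map p f q pf≗q [] = refl
prefixLength-map p f q pf≗q (y ∷ τ) rewrite pf≗q y = cong (λ r → if q y then suc r else 0) (prefixLength-map p f q pf≗q τ)

punchIn-<ᵇ : ∀ {N} (y : Fin (suc N)) a b → (toℕ (punchIn y a) <ᵇ toℕ (punchIn y b)) ≡ (toℕ a <ᵇ toℕ b)
punchIn-<ᵇ f0 a b = refl
punchIn-<ᵇ (fs y) f0 f0 = refl
punchIn-<ᵇ (fs y) f0 (fs b) = refl
punchIn-<ᵇ (fs y) (fs a) f0 = refl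
punchIn-<ᵇ (fs y) (fs a) (fs b) = punchIn-<ᵇ y a b

punchIn-<ᵇ-pivot : ∀ {N} (y : Fin (suc N)) a → (toℕ (punchIn y a) <ᵇ toℕ y) ≡ (toℕ a <ᵇ toℕ y)
punchIn-<ᵇ-pivot f0 a = refl
punchIn-<ᵇ-pivot (fs y) f0 = refl
punchIn-<ᵇ-pivot (fs y) (fs a) = punchIn-<ᵇ-pivot y a

headRun-≤ : ∀ {m n} (σ : Vec (Fin n) (suc m)) → headRun σ ≤ m
headRun-≤ (x ∷ τ) = prefixLength-≤ _ τ

headRun-map-punchIn : ∀ {m N} (y : Fin (suc N)) (σ : Vec (Fin N) (suc m)) → headRun (map (punchIn y) σ) ≡ headRun σ
headRun-map-punchIn y (x ∷ τ) = prefixLength-map _ (punchIn y) _ (punchIn-<ᵇ y x) τ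

headRun-∷ʳ-full : ∀ {m N} (x : Fin N) (τ : Vec (Fin N) m) z →
                  headRun (x ∷ τ) ≡ m → headRun ((x ∷ τ) ∷ʳ z) ≡ m + ⟦ toℕ x <ᵇ toℕ z ⟧
headRun-∷ʳ-full x τ z = prefixLength-∷ʳ-full _ τ z

headRun-∷ʳ-short : ∀ {m N} (σ : Vec (Fin N) (suc m)) z → headRun σ ≢ m → headRun (σ ∷ʳ z) ≡ headRun σ
headRun-∷ʳ-short (x ∷ τ) z = prefixLength-∷ʳ-short _ τ z

headRun-full⇒head≡0 : ∀ {n} (x : Fin (suc n)) τ → T (isPerm (x ∷ τ)) → headRun (x ∷ τ) ≡ n → x ≡ f0
headRun-full⇒head≡0 x τ perm full with injective⇒surjective (x ∷ τ) (Equivalence.to (T-isInjective (x ∷ τ)) perm) f0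
... | f0 , x≡0 = x≡0
... | fs k , τk≡0 = ⊥-elim (subst (λ c → T (toℕ x <ᵇ toℕ c)) τk≡0 (prefixLength-full _ τ full k))

headRun-∷ʳ : ∀ {n} (σ : Vec (Fin (suc n)) (suc n)) → T (isPerm σ) → ∀ y →
             headRun (map (punchIn y) σ ∷ʳ y) ≡ headRun σ + ⟦ (headRun σ ≡ᵇ n) ∧ (0 <ᵇ toℕ y) ⟧
headRun-∷ʳ {n} σ@(x ∷ τ) perm y with headRun σ ℕ.≟ n
... | yes full = begin
  headRun (map (punchIn y) σ ∷ʳ y)
    ≡⟨ headRun-∷ʳ-full (punchIn y x) (map (punchIn y) τ) y (trans (headRun-map-punchIn y σ) full) ⟩
  n + ⟦ toℕ (punchIn y x) <ᵇ toℕ y ⟧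
    ≡⟨ cong (λ b → n + ⟦ b ⟧) (punchIn-<ᵇ-pivot y x) ⟩
  n + ⟦ toℕ x <ᵇ toℕ y ⟧
    ≡⟨ cong (λ x′ → n + ⟦ toℕ x′ <ᵇ toℕ y ⟧) (headRun-full⇒head≡0 x τ perm full) ⟩
  n + ⟦ true ∧ (0 <ᵇ toℕ y) ⟧
    ≡⟨ sym (cong₂ (λ r b → r + ⟦ b ∧ (0 <ᵇ toℕ y) ⟧) full (trans (cong (_≡ᵇ n) full) (≡ᵇ-refl n))) ⟩
  headRun σ + ⟦ (headRun σ ≡ᵇ n) ∧ (0 <ᵇ toℕ y) ⟧ ∎
  where open ≡-Reasoning
... | no short = begin
  headRun (map (punchIn y) σ ∷ʳ y)
    ≡⟨ headRun-∷ʳ-short (map (punchIn y) σ) y (short ∘ trans (sym (headRun-map-punchIn y σ))) ⟩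
  headRun (map (punchIn y) σ)
    ≡⟨ headRun-map-punchIn y σ ⟩
  headRun σ
    ≡⟨ sym (+-identityʳ _) ⟩
  headRun σ + ⟦ false ∧ (0 <ᵇ toℕ y) ⟧
    ≡⟨ cong (λ b → headRun σ + ⟦ b ∧ (0 <ᵇ toℕ y) ⟧) (sym (≢⇒≡ᵇ-false short)) ⟩
  headRun σ + ⟦ (headRun σ ≡ᵇ n) ∧ (0 <ᵇ toℕ y) ⟧ ∎
  where open ≡-Reasoning

headRunCount : ℕ → ℕ → ℕ
headRunCount n k = ∑[ π ∈ Sn (suc n) ] ⟦ headRun π ≡ᵇ k ⟧

module _ (n : ℕ) where

  private
    bump : ℕ → Bool → ℕ
    bump r b = r + ⟦ (r ≡ᵇ n) ∧ b ⟧

    bump-false : ∀ r k → (bump r false ≡ᵇ k) ≡ (r ≡ᵇ k)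
    bump-false r k = cong (_≡ᵇ k) (trans (cong (λ b → r + ⟦ b ⟧) (∧-zeroʳ (r ≡ᵇ n))) (+-identityʳ r))

    bump-true-n : ∀ r → (bump r true ≡ᵇ n) ≡ false
    bump-true-n r with r ℕ.≟ n
    ... | yes refl rewrite ∧-identityʳ (r ≡ᵇ r) | ≡ᵇ-refl r =
      ≢⇒≡ᵇ-false (λ e → m≢1+m+n r (trans (sym e) (+-suc r 0)))
    ... | no r≢n rewrite ≢⇒≡ᵇ-false r≢n = ≢⇒≡ᵇ-false (r≢n ∘ trans (sym (+-identityʳ r)))

    bump-true-suc : ∀ r → r ≤ n → (bump r true ≡ᵇ suc n) ≡ (r ≡ᵇ n)
    bump-true-suc r r≤n with r ℕ.≟ n
    ... | yes refl rewrite ≡ᵇ-refl r = trans (cong (_≡ᵇ suc r) (+-comm r 1)) (≡ᵇ-refl (suc r))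
    ... | no r≢n rewrite ≢⇒≡ᵇ-false r≢n =
      ≢⇒≡ᵇ-false (λ e → <-irrefl (trans (sym (+-identityʳ r)) e) (s≤s r≤n))

  headRunCount-suc : ∀ k → headRunCount (suc n) k ≡
                     ∑[ y < suc (suc n) ] ∑[ σ ∈ Sn (suc n) ] ⟦ bump (headRun σ) (0 <ᵇ toℕ y) ≡ᵇ k ⟧
  headRunCount-suc k = trans (∑-Sn-suc-∷ʳ (suc n) (λ π → ⟦ headRun π ≡ᵇ k ⟧))
    (sum-cong-≗ {suc (suc n)} λ y → ∑-Sn-cong (suc n) λ σ perm → cong (λ r → ⟦ r ≡ᵇ k ⟧) (headRun-∷ʳ σ perm y))

  headRunCount-suc-< : ∀ k → k < n → headRunCount (suc n) k ≡ suc (suc n) * headRunCount n k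
  headRunCount-suc-< k k<n = begin
    headRunCount (suc n) k
      ≡⟨ headRunCount-suc k ⟩
    ∑[ y < suc (suc n) ] ∑[ σ ∈ Sn (suc n) ] ⟦ bump (headRun σ) (0 <ᵇ toℕ y) ≡ᵇ k ⟧
      ≡⟨ sum-cong-≗ {suc (suc n)} (λ y → ∑-Sn-cong (suc n) λ σ _ →
           cong ⟦_⟧ (unchanged (headRun σ) (0 <ᵇ toℕ y))) ⟩
    ∑[ y < suc (suc n) ] headRunCount n k
      ≡⟨ ∑-const (suc (suc n)) (headRunCount n k) ⟩
    suc (suc n) * headRunCount n k ∎
    where
    open ≡-Reasoning
    unchanged : ∀ r b → (bump r b ≡ᵇ k) ≡ (r ≡ᵇ k)
    unchanged r b with r ℕ.≟ n
    ... | yes refl = trans (≢⇒≡ᵇ-false λ e → <-irrefl (sym e) (ℕ.<-≤-trans k<n (m≤m+n r _)))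
                           (sym (≢⇒≡ᵇ-false λ e → <-irrefl (sym e) k<n))
    ... | no r≢n rewrite ≢⇒≡ᵇ-false r≢n = cong (_≡ᵇ k) (+-identityʳ r)

  headRunCount-suc-≡ : headRunCount (suc n) n ≡ headRunCount n n
  headRunCount-suc-≡ = begin
    headRunCount (suc n) n
      ≡⟨ headRunCount-suc n ⟩
    ∑[ σ ∈ Sn (suc n) ] ⟦ bump (headRun σ) false ≡ᵇ n ⟧ +
      ∑[ y < suc n ] ∑[ σ ∈ Sn (suc n) ] ⟦ bump (headRun σ) true ≡ᵇ n ⟧
      ≡⟨ cong₂ _+_ (∑ₗ-cong (Sn (suc n)) λ σ → cong ⟦_⟧ (bump-false (headRun σ) n))
                   (trans (sum-cong-≗ {suc n} λ _ →
                             trans (∑ₗ-cong (Sn (suc n)) λ σ → cong ⟦_⟧ (bump-true-n (headRun σ))) (∑ₗ-zero (Sn (suc n))))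
                          (sum-replicate-zero (suc n))) ⟩
    headRunCount n n + 0
      ≡⟨ +-identityʳ _ ⟩
    headRunCount n n ∎
    where open ≡-Reasoning

  headRunCount-suc-suc : headRunCount (suc n) (suc n) ≡ suc n * headRunCount n n
  headRunCount-suc-suc = begin
    headRunCount (suc n) (suc n)
      ≡⟨ headRunCount-suc (suc n) ⟩
    ∑[ σ ∈ Sn (suc n) ] ⟦ bump (headRun σ) false ≡ᵇ suc n ⟧ +
      ∑[ y < suc n ] ∑[ σ ∈ Sn (suc n) ] ⟦ bump (headRun σ) true ≡ᵇ suc n ⟧
      ≡⟨ cong₂ _+_ (trans (∑ₗ-cong (Sn (suc n)) λ σ → cong ⟦_⟧ (trans (bump-false (headRun σ) (suc n))
                                                                     (≢⇒≡ᵇ-false λ e → <-irrefl e (s≤s (headRun-≤ σ)))))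
                          (∑ₗ-zero (Sn (suc n))))
                   (sum-cong-≗ {suc n} λ _ → ∑ₗ-cong (Sn (suc n)) λ σ →
                      cong ⟦_⟧ (bump-true-suc (headRun σ) (headRun-≤ σ))) ⟩
    0 + ∑[ y < suc n ] headRunCount n n
      ≡⟨ ∑-const (suc n) (headRunCount n n) ⟩
    suc n * headRunCount n n ∎
    where open ≡-Reasoning

headRunCount-diag : ∀ n → headRunCount n n ≡ n !
headRunCount-diag zero = refl
headRunCount-diag (suc n) = trans (headRunCount-suc-suc n) (cong (suc n *_) (headRunCount-diag n))

headRunCount-closed : ∀ k m → k < m → headRunCount m k * ((k + 1) * (k + 2)) ≡ suc m !
headRunCount-closed k (suc m) k<1+m with m≤n⇒m<n∨m≡n (s≤s⁻¹ k<1+m)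
... | inj₂ refl = begin
  headRunCount (suc k) k * ((k + 1) * (k + 2))
    ≡⟨ cong (_* ((k + 1) * (k + 2))) (trans (headRunCount-suc-≡ k) (headRunCount-diag k)) ⟩
  k ! * ((k + 1) * (k + 2))
    ≡⟨ solve 2 (λ a k → a :* ((k :+ con 1) :* (k :+ con 2)) := (con 2 :+ k) :* ((con 1 :+ k) :* a)) refl (k !) k ⟩
  suc (suc k) ! ∎
  where
  open ≡-Reasoning
  open +-*-Solver
... | inj₁ k<m = begin
  headRunCount (suc m) k * ((k + 1) * (k + 2))
    ≡⟨ cong (_* ((k + 1) * (k + 2))) (headRunCount-suc-< m k k<m) ⟩
  suc (suc m) * headRunCount m k * ((k + 1) * (k + 2))
    ≡⟨ *-assoc (suc (suc m)) (headRunCount m k) ((k + 1) * (k + 2)) ⟩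
  suc (suc m) * (headRunCount m k * ((k + 1) * (k + 2)))
    ≡⟨ cong (suc (suc m) *_) (headRunCount-closed k m k<m) ⟩
  suc (suc m) ! ∎
  where open ≡-Reasoning

s-reverse-transpose : ∀ R R′ → R′ ≡ List.reverse (List.map swap R) → ∀ n k → s R′ n k ≡ s R n k
s-reverse-transpose R R′ refl n k = trans (s-reverse (List.map swap R) n k) (s-transpose R n k)

s-reverse-rotate : ∀ R R′ → R′ ≡ List.reverse (List.map rotateCell R) → ∀ n k → s R′ n k ≡ s R n k
s-reverse-rotate R R′ refl n k = trans (s-reverse (List.map rotateCell R) n k) (s-rotate R n k)

s-meshes : ∀ p n k → s (meshes p) n k ≡ s (column₀ (c1 , c0)) n k
s-meshes p n k = orbit p
  where
  m₁ m₂ m₃ m₄ m₅ m₆ m₇ m₈ : Mesh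
  m₁ = meshes f0
  m₂ = meshes (fs f0)
  m₃ = meshes (fs (fs f0))
  m₄ = meshes (fs (fs (fs f0)))
  m₅ = meshes (fs (fs (fs (fs f0))))
  m₆ = meshes (fs (fs (fs (fs (fs f0)))))
  m₇ = meshes (fs (fs (fs (fs (fs (fs f0))))))
  m₈ = meshes (fs (fs (fs (fs (fs (fs (fs f0)))))))
  s₄ : s m₄ n k ≡ s m₂ n k
  s₄ = s-reverse-transpose m₂ m₄ refl n k
  s₁ : s m₁ n k ≡ s m₂ n k
  s₁ = trans (s-reverse-rotate m₄ m₁ refl n k) s₄
  s₃ : s m₃ n k ≡ s m₂ n k
  s₃ = trans (s-reverse-transpose m₁ m₃ refl n k) s₁
  s₇ : s m₇ n k ≡ s m₂ n k
  s₇ = s-reverseTail n k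
  s₈ : s m₈ n k ≡ s m₂ n k
  s₈ = trans (s-reverse-transpose m₇ m₈ refl n k) s₇
  s₅ : s m₅ n k ≡ s m₂ n k
  s₅ = trans (s-reverse-rotate m₈ m₅ refl n k) s₈
  s₆ : s m₆ n k ≡ s m₂ n k
  s₆ = trans (s-reverse-transpose m₅ m₆ refl n k) s₅
  orbit : ∀ p → s (meshes p) n k ≡ s m₂ n k
  orbit f0 = s₁
  orbit (fs f0) = refl
  orbit (fs (fs f0)) = s₃
  orbit (fs (fs (fs f0))) = s₄
  orbit (fs (fs (fs (fs f0)))) = s₅
  orbit (fs (fs (fs (fs (fs f0))))) = s₆
  orbit (fs (fs (fs (fs (fs (fs f0)))))) = s₇
  orbit (fs (fs (fs (fs (fs (fs (fs f0))))))) = s₈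

s-column₀-headRun : ∀ n k → s (column₀ (c1 , c0)) (suc n) k ≡ headRunCount n k
s-column₀-headRun n k = trans (s-∑ (column₀ (c1 , c0)) (suc n) k)
  (∑-Sn-cong (suc n) λ π perm → cong (λ r → ⟦ r ≡ᵇ k ⟧) (occ-column₀-headRun π perm))

theorem3p4 : ((p q : Fin 8) → (n k : ℕ) → s (meshes p) n k ≡ s (meshes q) n k)
    × ((p : Fin 8) → (n : ℕ) → s (meshes p) (suc n) n ≡ n !)
    × ((p : Fin 8) → (n k : ℕ) → 2 ≤ n → k ≤ n ∸ 2 → s (meshes p) n k * ((k + 1) * (k + 2)) ≡ n !)
theorem3p4 =
    (λ p q n k → trans (s-meshes p n k) (sym (s-meshes q n k)))
  , (λ p n → trans (s-meshes p (suc n) n) (trans (s-column₀-headRun n n) (headRunCount-diag n)))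
  , λ { p (suc zero) k (s≤s ()) _
      ; p (suc (suc m)) k _ k≤m →
          trans (cong (_* ((k + 1) * (k + 2))) (trans (s-meshes p (suc (suc m)) k) (s-column₀-headRun (suc m) k)))
                (headRunCount-closed k (suc m) (s≤s k≤m)) }
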